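{- Let $p$ be an odd prime and $s$ a positive integer. Let $\mathcal{T}(s)$ be the number of tuples $(x_1,\dots,x_s,y_1,\dots,y_s)$ of integers with $1\le x_i,y_i\le p-1$ such that \[ x_1\cdots x_s\equiv y_1\cdots y_s \pmod p \quad\text{and}\quad \prod_{i=1}^{s}(x_i-1)\equiv \prod_{i=1}^{s}(y_i-1)\pmod p. \] Then \[ \mathcal{T}(s)=(p-1)^{2s-1}-2(p-2)\left((p-1)^{s-1}(p-2)^{s-1}-p^{s-1}\right)+f(p,s), \] where \[ f(p,s)=\frac{p(p-2)^2\left((p-2)^{2s-2}-p^{s-1}\right)}{(p-1)^2}-\frac{(p^2-4)(p^{s-1}-1)}{(p-1)^2}. \] -}

module Defs where

open import Data.Nat as ℕ using (ℕ; zero; suc; _∸_)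
open import Data.Nat.Divisibility as ℕD using (_∣?_)
open import Data.Integer as ℤ using (ℤ; +_; _-_; _*_; _^_)
open import Data.Integer.Divisibility as ℤD using ()
open import Data.Rational as ℚ using (ℚ; _/_)
open import Data.List as List using (List; []; _∷_; upTo; length; filter; concatMap; cartesianProduct)
open import Data.Product using (_×_; _,_)
open import Relation.Nullary using (Dec; _×-dec_)

tuples : ℕ → ℕ → List (List ℕ)
tuples p zero    = [] ∷ []
tuples p (suc s) = concatMap (λ x → List.map (x ∷_) (tuples p s)) (List.map suc (upTo (p ∸ 1)))

_≡_[mod_] : ℤ → ℤ → ℕ → Set
a ≡ b [mod p ] = (+ p) ℤD.∣ (a - b)

_≡?_[mod_] : (a b : ℤ) (p : ℕ) → Dec (a ≡ b [mod p ])
a ≡? b [mod p ] = p ∣? ℤ.∣ a - b ∣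

prodℤ' : List ℤ → ℤ
prodℤ' []       = + 1
prodℤ' (z ∷ zs) = z * prodℤ' zs

prodℤ : List ℕ → ℤ
prodℤ xs = prodℤ' (List.map +_ xs)

prodMinus1 : List ℕ → ℤ
prodMinus1 xs = prodℤ' (List.map (λ x → + x - + 1) xs)

Cond : ℕ → List ℕ × List ℕ → Set
Cond p (xs , ys) = (prodℤ xs ≡ prodℤ ys [mod p ]) × (prodMinus1 xs ≡ prodMinus1 ys [mod p ])

cond? : (p : ℕ) (xy : List ℕ × List ℕ) → Dec (Cond p xy)
cond? p (xs , ys) = (prodℤ xs ≡? prodℤ ys [mod p ]) ×-dec (prodMinus1 xs ≡? prodMinus1 ys [mod p ])

𝒯 : ℕ → ℕ → ℕ
𝒯 p s = length (filter (cond? p) (cartesianProduct (tuples p s) (tuples p s)))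

mainTerm : ℕ → ℕ → ℤ
mainTerm p s =
  (P - + 1) ^ (2 ℕ.* s ∸ 1)
  - + 2 * (P - + 2) * ((P - + 1) ^ (s ∸ 1) * (P - + 2) ^ (s ∸ 1) - P ^ (s ∸ 1))
  where P = + p

-- f(p,s) = p(p-2)²((p-2)^{2s-2} - p^{s-1})/(p-1)² - (p²-4)(p^{s-1}-1)/(p-1)²
-- (defined for p ≥ 2, where p - 1 ≠ 0; junk value 0 for p < 2)
f : ℕ → ℕ → ℚ
f zero          s = ℚ.0ℚ
f (suc zero)    s = ℚ.0ℚ
f p@(suc (suc r)) s =
  (P * (P - + 2) ^ 2 * ((P - + 2) ^ (2 ℕ.* s ∸ 2) - P ^ (s ∸ 1))) / (suc r ℕ.* suc r)
  ℚ.- ((P ^ 2 - + 4) * (P ^ (s ∸ 1) - + 1)) / (suc r ℕ.* suc r)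
  where P = + p

-- Work in 𝔽ₚ and write ∏ x = x₁⋯xₛ and ∏₋₁ x = (x₁ − 1)⋯(xₛ − 1). A pair (x, y) with
-- ∏₋₁ x = ∏₋₁ y = 0 only has to satisfy ∏ x = ∏ y; these pairs are counted by
-- inclusion–exclusion, since every fibre of ∏ on tuples of length s has (p − 1)^(s − 1)
-- elements. For a pair whose ∏₋₁ values are units, consider the conditions
-- ∏ x = ∏ y, ∏₋₁ x = ∏₋₁ y and ∏ x ∏₋₁ y = ∏ y ∏₋₁ x. Appending one coordinate ≠ 1 to
-- each tuple makes each condition linear in the new coordinates, and it then holds for
-- p − 2 of the (p − 2)² choices if it held before and for p − 3 otherwise. Any two of
-- the three conditions imply the third, which also gives a recurrence for the pairs
-- satisfying the first two.

module Submission where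

open import Defs
open import Data.Nat as ℕ using (ℕ; zero; suc; _∸_; s≤s; _≟_; nonTrivial⇒n>1)
import Data.Nat.Properties as ℕP
import Data.List.Properties as LP
open import Algebra.Properties.CommutativeSemigroup ℕP.+-commutativeSemigroup using (interchange)
open import Data.Bool using (if_then_else_)
open import Data.List as List using (List; []; _∷_; _++_; upTo; length; filter; concatMap; cartesianProduct)
open import Data.List.Relation.Unary.All as All using (All; []; _∷_)
import Data.List.Relation.Unary.All.Properties as AllP
open import Data.Product using (_×_; _,_; ∃; proj₁; proj₂)
open import Data.Empty using (⊥; ⊥-elim)
open import Function using (_∘_; id)
open import Relation.Nullary using (Dec; yes; no; does; ¬_; ¬?; _×-dec_)
open import Relation.Unary using (Decidable)
open import Relation.Binary.PropositionalEquality
open import Data.Rational as ℚ using (_/_; toℚᵘ)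
import Data.Rational.Properties as ℚP
open import Data.Rational.Unnormalised as ℚᵘ using (mkℚᵘ)
import Data.Rational.Unnormalised.Properties as ℚᵘP
open import Relation.Nullary.Decidable using (map′)
open import Relation.Binary.Bundles using (Setoid)
open import Relation.Binary.Core using (_Preserves_⟶_)
open import Level using (0ℓ)
import Relation.Binary.Reasoning.Setoid as SetoidReasoning
open import Data.Nat.Primality using (Prime; prime⇒nonZero; prime⇒nonTrivial; euclidsLemma; ¬prime[0]; ¬prime[1])
open import Data.Integer as ℤ using (ℤ; ∣_∣; +_; 0ℤ; 1ℤ; _+_; _-_; -_; _*_; _^_)
import Data.Integer.Properties as ℤP
import Data.Integer.Divisibility.Signed as S
import Data.Integer.Divisibility as ℤD
open import Data.Integer.DivMod using (_%ℕ_; _/ℕ_; n%ℕd<d; a≡a%ℕn+[a/ℕn]*n)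
open import Data.Nat.Coprimality using (coprime-Bézout; prime⇒coprime)
import Data.Nat.GCD as GCD
open GCD using (module Bézout)
import Data.Nat.Divisibility as ℕD
open import Data.Sum as Sum using (_⊎_; inj₁; inj₂)
open import Data.Integer.Tactic.RingSolver using (solve-∀)
import Data.Nat.Tactic.RingSolver as ℕ-Solver

private
  variable
    A B P Q : Set

-- Finite sums and indicators

∑ : List A → (A → ℕ) → ℕ
∑ []       f = 0
∑ (x ∷ xs) f = f x ℕ.+ ∑ xs f

𝟙 : Dec P → ℕ
𝟙 d = if does d then 1 else 0

∑-cong : (xs : List A) {f g : A → ℕ} → (∀ x → f x ≡ g x) → ∑ xs f ≡ ∑ xs g
∑-cong []       f≗g = refl
∑-cong (x ∷ xs) f≗g = cong₂ ℕ._+_ (f≗g x) (∑-cong xs f≗g)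

∑-congᴬ : {P : A → Set} {xs : List A} {f g : A → ℕ} →
          All P xs → (∀ x → P x → f x ≡ g x) → ∑ xs f ≡ ∑ xs g
∑-congᴬ []         f≗g = refl
∑-congᴬ (px ∷ pxs) f≗g = cong₂ ℕ._+_ (f≗g _ px) (∑-congᴬ pxs f≗g)

∑-+ : (xs : List A) (f g : A → ℕ) → ∑ xs (λ x → f x ℕ.+ g x) ≡ ∑ xs f ℕ.+ ∑ xs g
∑-+ []       f g = refl
∑-+ (x ∷ xs) f g rewrite ∑-+ xs f g = interchange (f x) (g x) (∑ xs f) (∑ xs g)

∑-*ˡ : (xs : List A) (c : ℕ) (f : A → ℕ) → ∑ xs (λ x → c ℕ.* f x) ≡ c ℕ.* ∑ xs f
∑-*ˡ []       c f = sym (ℕP.*-zeroʳ c)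
∑-*ˡ (x ∷ xs) c f rewrite ∑-*ˡ xs c f = sym (ℕP.*-distribˡ-+ c (f x) (∑ xs f))

∑-*ʳ : (xs : List A) (c : ℕ) (f : A → ℕ) → ∑ xs (λ x → f x ℕ.* c) ≡ ∑ xs f ℕ.* c
∑-*ʳ xs c f = begin
  ∑ xs (λ x → f x ℕ.* c) ≡⟨ ∑-cong xs (λ x → ℕP.*-comm (f x) c) ⟩
  ∑ xs (λ x → c ℕ.* f x) ≡⟨ ∑-*ˡ xs c f ⟩
  c ℕ.* ∑ xs f           ≡⟨ ℕP.*-comm c (∑ xs f) ⟩
  ∑ xs f ℕ.* c           ∎
  where open ≡-Reasoning

∑-const : (xs : List A) (c : ℕ) → ∑ xs (λ _ → c) ≡ length xs ℕ.* c
∑-const []       c = refl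
∑-const (x ∷ xs) c = cong (c ℕ.+_) (∑-const xs c)

∑-zero : (xs : List A) → ∑ xs (λ _ → 0) ≡ 0
∑-zero xs = trans (∑-const xs 0) (ℕP.*-zeroʳ (length xs))

∑-++ : (xs ys : List A) (f : A → ℕ) → ∑ (xs ++ ys) f ≡ ∑ xs f ℕ.+ ∑ ys f
∑-++ []       ys f = refl
∑-++ (x ∷ xs) ys f rewrite ∑-++ xs ys f = sym (ℕP.+-assoc (f x) (∑ xs f) (∑ ys f))

length-filter≡∑𝟙 : {P : A → Set} (P? : Decidable P) (xs : List A) →
                   length (filter P? xs) ≡ ∑ xs (λ x → 𝟙 (P? x))
length-filter≡∑𝟙 P? []       = refl
length-filter≡∑𝟙 P? (x ∷ xs) with P? x
... | yes _ = cong suc (length-filter≡∑𝟙 P? xs)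
... | no  _ = length-filter≡∑𝟙 P? xs

∑-map : (h : A → B) (xs : List A) (f : B → ℕ) → ∑ (List.map h xs) f ≡ ∑ xs (f ∘ h)
∑-map h []       f = refl
∑-map h (x ∷ xs) f = cong (f (h x) ℕ.+_) (∑-map h xs f)

∑-concatMap : (F : A → List B) (xs : List A) (f : B → ℕ) →
              ∑ (concatMap F xs) f ≡ ∑ xs (λ x → ∑ (F x) f)
∑-concatMap F []       f = refl
∑-concatMap F (x ∷ xs) f =
  trans (∑-++ (F x) (concatMap F xs) f) (cong (∑ (F x) f ℕ.+_) (∑-concatMap F xs f))

∑-cartesianProduct : (xs : List A) (ys : List B) (f : A × B → ℕ) →
                     ∑ (cartesianProduct xs ys) f ≡ ∑ xs (λ x → ∑ ys (λ y → f (x , y)))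
∑-cartesianProduct []       ys f = refl
∑-cartesianProduct (x ∷ xs) ys f =
  trans (∑-++ (List.map (x ,_) ys) (cartesianProduct xs ys) f)
        (cong₂ ℕ._+_ (∑-map (x ,_) ys f) (∑-cartesianProduct xs ys f))

∑-comm : (xs : List A) (ys : List B) (f : A → B → ℕ) →
         ∑ xs (λ x → ∑ ys (f x)) ≡ ∑ ys (λ y → ∑ xs (λ x → f x y))
∑-comm []       ys f = sym (∑-zero ys)
∑-comm (x ∷ xs) ys f rewrite ∑-comm xs ys f = sym (∑-+ ys (f x) (λ y → ∑ xs (λ x → f x y)))

∑-upTo-suc : ∀ n (f : ℕ → ℕ) → ∑ (upTo (suc n)) f ≡ f 0 ℕ.+ ∑ (upTo n) (f ∘ suc)
∑-upTo-suc n f = cong (f 0 ℕ.+_) (trans (cong (λ xs → ∑ xs f) (sym (LP.map-upTo suc n))) (∑-map suc (upTo n) f))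

∑-upTo-𝟙≟ : ∀ n r → ∑ (upTo n) (λ i → 𝟙 (i ≟ r)) ≡ 𝟙 (r ℕ.<? n)
∑-upTo-𝟙≟ zero    r       = refl
∑-upTo-𝟙≟ (suc n) zero    = trans (∑-upTo-suc n (λ i → 𝟙 (i ≟ 0))) (cong suc (∑-zero (upTo n)))
∑-upTo-𝟙≟ (suc n) (suc r) = trans (∑-upTo-suc n (λ i → 𝟙 (i ≟ suc r))) (∑-upTo-𝟙≟ n r)

𝟙-yes : (d : Dec P) → P → 𝟙 d ≡ 1
𝟙-yes (yes _) _  = refl
𝟙-yes (no ¬p) p  = ⊥-elim (¬p p)

𝟙-no : (d : Dec P) → ¬ P → 𝟙 d ≡ 0
𝟙-no (yes p) ¬p = ⊥-elim (¬p p)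
𝟙-no (no _)  _  = refl

𝟙-⇔ : (d : Dec P) (e : Dec Q) → (P → Q) → (Q → P) → 𝟙 d ≡ 𝟙 e
𝟙-⇔ (yes p) e       to from = sym (𝟙-yes e (to p))
𝟙-⇔ (no ¬p) e       to from = sym (𝟙-no e (λ q → ¬p (from q)))

𝟙-¬ : (d : Dec P) → 𝟙 (¬? d) ℕ.+ 𝟙 d ≡ 1
𝟙-¬ (yes _) = refl
𝟙-¬ (no _)  = refl

𝟙-idem : (d : Dec P) → 𝟙 d ℕ.* 𝟙 d ≡ 𝟙 d
𝟙-idem (yes _) = refl
𝟙-idem (no _)  = refl

𝟙-× : (d : Dec P) (e : Dec Q) → 𝟙 (d ×-dec e) ≡ 𝟙 d ℕ.* 𝟙 e
𝟙-× (yes _) (yes _) = refl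
𝟙-× (yes _) (no _)  = refl
𝟙-× (no _)  _       = refl

𝟙*𝟙-exclusive : (d : Dec P) (e : Dec Q) → (P → Q → ⊥) → 𝟙 d ℕ.* 𝟙 e ≡ 0
𝟙*𝟙-exclusive (yes p) (yes q) exclusive = ⊥-elim (exclusive p q)
𝟙*𝟙-exclusive (yes _) (no _)  _         = refl
𝟙*𝟙-exclusive (no _)  _       _         = refl

𝟙-two-of-three : ∀ {R} (d : Dec P) (e : Dec Q) (f : Dec R) →
                 (P → Q → R) → (P → R → Q) → (Q → R → P) →
                 𝟙 (¬? d) ℕ.* 𝟙 (¬? e) ℕ.* 𝟙 (¬? f) ℕ.+ 𝟙 d ℕ.+ 𝟙 e ℕ.+ 𝟙 f ≡ 1 ℕ.+ 2 ℕ.* (𝟙 d ℕ.* 𝟙 e)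
𝟙-two-of-three (yes _) (yes _) (yes _) _   _   _   = refl
𝟙-two-of-three (yes p) (yes q) (no ¬r) pq⇒r _   _   = ⊥-elim (¬r (pq⇒r p q))
𝟙-two-of-three (yes p) (no ¬q) (yes r) _   pr⇒q _   = ⊥-elim (¬q (pr⇒q p r))
𝟙-two-of-three (yes _) (no _)  (no _)  _   _   _   = refl
𝟙-two-of-three (no ¬p) (yes q) (yes r) _   _   qr⇒p = ⊥-elim (¬p (qr⇒p q r))
𝟙-two-of-three (no _)  (yes _) (no _)  _   _   _   = refl
𝟙-two-of-three (no _)  (no _)  (yes _) _   _   _   = refl
𝟙-two-of-three (no _)  (no _)  (no _)  _   _   _   = refl

-- Integer arithmetic and the recurrences

∣∧<⇒≡0 : ∀ {p n} → p ℕD.∣ n → n ℕ.< p → n ≡ 0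
∣∧<⇒≡0 {n = zero}  _   _   = refl
∣∧<⇒≡0 {n = suc n} p∣n n<p = ⊥-elim (ℕP.<⇒≱ n<p (ℕD.∣⇒≤ p∣n))

<∸1⇒suc< : ∀ {i n} → i ℕ.< n ∸ 1 → suc i ℕ.< n
<∸1⇒suc< {n = suc n} i<n = s≤s i<n

suc<⇒<∸1 : ∀ {i n} → suc i ℕ.< n → i ℕ.< n ∸ 1
suc<⇒<∸1 {n = suc n} (s≤s i<n) = i<n

*-identityˡʳ : ∀ {a c} b → a ≡ 1 → c ≡ 1 → a ℕ.* b ℕ.* c ≡ b
*-identityˡʳ b refl refl = trans (ℕP.*-identityʳ (1 ℕ.* b)) (ℕP.*-identityˡ b)

1+*≡*⇒ℤ : ∀ a b c d → 1 ℕ.+ a ℕ.* b ≡ c ℕ.* d → 1ℤ + + a * + b ≡ + c * + d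
1+*≡*⇒ℤ a b c d eq = begin
  1ℤ + + a * + b    ≡⟨ cong (λ k → 1ℤ + k) (ℤP.pos-* a b) ⟨
  + (1 ℕ.+ a ℕ.* b) ≡⟨ cong +_ eq ⟩
  + (c ℕ.* d)       ≡⟨ ℤP.pos-* c d ⟩
  + c * + d         ∎
  where open ≡-Reasoning

pos-^ : ∀ m n → + (m ℕ.^ n) ≡ (+ m) ^ n
pos-^ m zero    = refl
pos-^ m (suc n) = trans (ℤP.pos-* m (m ℕ.^ n)) (cong (+ m *_) (pos-^ m n))

complement-step : ∀ {x y c k m} → x ℕ.+ c ≡ k ℕ.* m → y ℕ.+ c ≡ m → + x ≡ (+ k - + 1) * + m + + y
complement-step {x} {y} {c} {k} {m} x+c≡km y+c≡m = begin
  + x                                          ≡⟨ rearrange (+ x) (+ y) (+ c) ⟩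
  (+ x + + c) - (+ y + + c) + + y              ≡⟨ cong₂ (λ u v → u - v + + y) (trans (sym (ℤP.pos-+ x c)) (trans (cong +_ x+c≡km) (ℤP.pos-* k m)))
                                                                          (trans (sym (ℤP.pos-+ y c)) (cong +_ y+c≡m)) ⟩
  + k * + m - + m + + y                        ≡⟨ factor (+ k) (+ m) (+ y) ⟩
  (+ k - + 1) * + m + + y                      ∎
  where
  open ≡-Reasoning
  rearrange : ∀ x y c → x ≡ (x + c) - (y + c) + y
  rearrange = solve-∀
  factor : ∀ k m y → k * m - m + y ≡ (k - + 1) * m + y
  factor = solve-∀

2[1+s]≡2+[s+s] : ∀ s → 2 ℕ.* suc s ≡ 2 ℕ.+ (s ℕ.+ s)
2[1+s]≡2+[s+s] = ℕ-Solver.solve-∀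

^-2[1+s]∸1 : ∀ i s → i ^ (2 ℕ.* suc s ∸ 1) ≡ i * (i ^ s * i ^ s)
^-2[1+s]∸1 i s = trans (cong (λ n → i ^ (n ∸ 1)) (2[1+s]≡2+[s+s] s)) (cong (i *_) (ℤP.^-distribˡ-+-* i s s))

^-2[1+s]∸2 : ∀ i s → i ^ (2 ℕ.* suc s ∸ 2) ≡ i ^ s * i ^ s
^-2[1+s]∸2 i s = trans (cong (λ n → i ^ (n ∸ 2)) (2[1+s]≡2+[s+s] s)) (ℤP.^-distribˡ-+-* i s s)

square-recurrence : ∀ (P : ℤ) (S : ℕ → ℤ) → S 0 ≡ + 1 →
  (∀ s → S (suc s) ≡ (P - + 3) * ((P - + 2) ^ s * (P - + 2) ^ s) + S s) →
  ∀ s → (P - + 1) * S s ≡ (P - + 2) ^ s * (P - + 2) ^ s + (P - + 2)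
square-recurrence P S S0≡1 S-suc zero = trans (cong ((P - + 1) *_) S0≡1) (base P)
  where base : ∀ P → (P - + 1) * + 1 ≡ + 1 * + 1 + (P - + 2)
        base = solve-∀
square-recurrence P S S0≡1 S-suc (suc s) = begin
  (P - + 1) * S (suc s)                                  ≡⟨ cong ((P - + 1) *_) (S-suc s) ⟩
  (P - + 1) * ((P - + 3) * (Y * Y) + S s)                ≡⟨ expand P Y (S s) ⟩
  (P - + 1) * (P - + 3) * (Y * Y) + (P - + 1) * S s      ≡⟨ cong (λ z → (P - + 1) * (P - + 3) * (Y * Y) + z) (square-recurrence P S S0≡1 S-suc s) ⟩
  (P - + 1) * (P - + 3) * (Y * Y) + (Y * Y + (P - + 2))  ≡⟨ collect P Y ⟩
  (P - + 2) * Y * ((P - + 2) * Y) + (P - + 2)            ∎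
  where
  open ≡-Reasoning
  Y = (P - + 2) ^ s
  expand : ∀ P Y S → (P - + 1) * ((P - + 3) * (Y * Y) + S) ≡ (P - + 1) * (P - + 3) * (Y * Y) + (P - + 1) * S
  expand = solve-∀
  collect : ∀ P Y → (P - + 1) * (P - + 3) * (Y * Y) + (Y * Y + (P - + 2)) ≡ (P - + 2) * Y * ((P - + 2) * Y) + (P - + 2)
  collect = solve-∀

both-recurrence : ∀ (P : ℤ) (W S : ℕ → ℤ) → W 0 ≡ + 1 →
  (∀ s → W (suc s) + S s ≡ P * W s + (P - + 2) ^ s * (P - + 2) ^ s) →
  (∀ s → (P - + 1) * S s ≡ + 3 * ((P - + 2) ^ s * (P - + 2) ^ s + (P - + 2))) →
  ∀ s → (P - + 1) * (P - + 1) * W s ≡ (P - + 2) * (P - + 3) * P ^ s + (P - + 2) ^ s * (P - + 2) ^ s + + 3 * (P - + 2)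
both-recurrence P W S W0≡1 W-suc S-closed zero = trans (cong ((P - + 1) * (P - + 1) *_) W0≡1) (base P)
  where base : ∀ P → (P - + 1) * (P - + 1) * + 1 ≡ (P - + 2) * (P - + 3) * + 1 + + 1 * + 1 + + 3 * (P - + 2)
        base = solve-∀
both-recurrence P W S W0≡1 W-suc S-closed (suc s) = begin
  (P - + 1) * (P - + 1) * W (suc s)
    ≡⟨ split P (W (suc s)) (S s) ⟩
  (P - + 1) * (P - + 1) * (W (suc s) + S s) - (P - + 1) * ((P - + 1) * S s)
    ≡⟨ cong₂ (λ u v → (P - + 1) * (P - + 1) * u - (P - + 1) * v) (W-suc s) (S-closed s) ⟩
  (P - + 1) * (P - + 1) * (P * W s + Y * Y) - (P - + 1) * (+ 3 * (Y * Y + (P - + 2)))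
    ≡⟨ expand P (W s) Y ⟩
  P * ((P - + 1) * (P - + 1) * W s) + (P - + 1) * (P - + 1) * (Y * Y) - (P - + 1) * (+ 3 * (Y * Y + (P - + 2)))
    ≡⟨ cong (λ u → P * u + (P - + 1) * (P - + 1) * (Y * Y) - (P - + 1) * (+ 3 * (Y * Y + (P - + 2))))
            (both-recurrence P W S W0≡1 W-suc S-closed s) ⟩
  P * ((P - + 2) * (P - + 3) * Pˢ + Y * Y + + 3 * (P - + 2)) + (P - + 1) * (P - + 1) * (Y * Y) - (P - + 1) * (+ 3 * (Y * Y + (P - + 2)))
    ≡⟨ collect P Y Pˢ ⟩
  (P - + 2) * (P - + 3) * (P * Pˢ) + (P - + 2) * Y * ((P - + 2) * Y) + + 3 * (P - + 2) ∎
  where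
  open ≡-Reasoning
  Y = (P - + 2) ^ s
  Pˢ = P ^ s
  split : ∀ P W S → (P - + 1) * (P - + 1) * W ≡ (P - + 1) * (P - + 1) * (W + S) - (P - + 1) * ((P - + 1) * S)
  split = solve-∀
  expand : ∀ P W Y → (P - + 1) * (P - + 1) * (P * W + Y * Y) - (P - + 1) * (+ 3 * (Y * Y + (P - + 2)))
                   ≡ P * ((P - + 1) * (P - + 1) * W) + (P - + 1) * (P - + 1) * (Y * Y) - (P - + 1) * (+ 3 * (Y * Y + (P - + 2)))
  expand = solve-∀
  collect : ∀ P Y Pˢ → P * ((P - + 2) * (P - + 3) * Pˢ + Y * Y + + 3 * (P - + 2)) + (P - + 1) * (P - + 1) * (Y * Y) - (P - + 1) * (+ 3 * (Y * Y + (P - + 2)))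
                    ≡ (P - + 2) * (P - + 3) * (P * Pˢ) + (P - + 2) * Y * ((P - + 2) * Y) + + 3 * (P - + 2)
  collect = solve-∀

closed-form-algebra : ∀ P X Y Q T W S →
  T + ((P - + 2) * Y * X + (P - + 2) * Y * X) ≡ W + ((P - + 1) * X * X + S) →
  (P - + 1) * S ≡ (P - + 2) * Y * ((P - + 2) * Y) + (P - + 2) →
  (P - + 1) * (P - + 1) * W ≡ (P - + 2) * (P - + 3) * (P * Q) + (P - + 2) * Y * ((P - + 2) * Y) + + 3 * (P - + 2) →
  (P - + 1) * (P - + 1) * T ≡ (P - + 1) * (P - + 1) * ((P - + 1) * (X * X) - + 2 * (P - + 2) * (X * Y - Q))
                              + P * (P - + 2) ^ 2 * (Y * Y - Q) - (P ^ 2 - + 4) * (Q - + 1)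
closed-form-algebra P X Y Q T W S T-eq S-eq W-eq = begin
  (P - + 1) * (P - + 1) * T
    ≡⟨ split P X Y T ⟩
  (P - + 1) * (P - + 1) * (T + ((P - + 2) * Y * X + (P - + 2) * Y * X)) - (P - + 1) * (P - + 1) * (+ 2 * ((P - + 2) * Y * X))
    ≡⟨ cong (λ z → (P - + 1) * (P - + 1) * z - (P - + 1) * (P - + 1) * (+ 2 * ((P - + 2) * Y * X))) T-eq ⟩
  (P - + 1) * (P - + 1) * (W + ((P - + 1) * X * X + S)) - (P - + 1) * (P - + 1) * (+ 2 * ((P - + 2) * Y * X))
    ≡⟨ expand P X Y W S ⟩
  (P - + 1) * (P - + 1) * W + (P - + 1) * ((P - + 1) * S) + (P - + 1) * (P - + 1) * ((P - + 1) * X * X - + 2 * ((P - + 2) * Y * X))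
    ≡⟨ cong₂ (λ u v → u + (P - + 1) * v + (P - + 1) * (P - + 1) * ((P - + 1) * X * X - + 2 * ((P - + 2) * Y * X))) W-eq S-eq ⟩
  (P - + 2) * (P - + 3) * (P * Q) + (P - + 2) * Y * ((P - + 2) * Y) + + 3 * (P - + 2)
    + (P - + 1) * ((P - + 2) * Y * ((P - + 2) * Y) + (P - + 2))
    + (P - + 1) * (P - + 1) * ((P - + 1) * X * X - + 2 * ((P - + 2) * Y * X))
    ≡⟨ collect P X Y Q ⟩
  (P - + 1) * (P - + 1) * ((P - + 1) * (X * X) - + 2 * (P - + 2) * (X * Y - Q)) + P * (P - + 2) ^ 2 * (Y * Y - Q) - (P ^ 2 - + 4) * (Q - + 1) ∎
  where
  open ≡-Reasoning
  split : ∀ P X Y T → (P - + 1) * (P - + 1) * T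
    ≡ (P - + 1) * (P - + 1) * (T + ((P - + 2) * Y * X + (P - + 2) * Y * X)) - (P - + 1) * (P - + 1) * (+ 2 * ((P - + 2) * Y * X))
  split = solve-∀
  expand : ∀ P X Y W S → (P - + 1) * (P - + 1) * (W + ((P - + 1) * X * X + S)) - (P - + 1) * (P - + 1) * (+ 2 * ((P - + 2) * Y * X))
    ≡ (P - + 1) * (P - + 1) * W + (P - + 1) * ((P - + 1) * S) + (P - + 1) * (P - + 1) * ((P - + 1) * X * X - + 2 * ((P - + 2) * Y * X))
  expand = solve-∀
  collect : ∀ P X Y Q → (P - + 2) * (P - + 3) * (P * Q) + (P - + 2) * Y * ((P - + 2) * Y) + + 3 * (P - + 2)
    + (P - + 1) * ((P - + 2) * Y * ((P - + 2) * Y) + (P - + 2))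
    + (P - + 1) * (P - + 1) * ((P - + 1) * X * X - + 2 * ((P - + 2) * Y * X))
    ≡ (P - + 1) * (P - + 1) * ((P - + 1) * (X * X) - + 2 * (P - + 2) * (X * Y - Q))
      + P * ((P - + 2) * ((P - + 2) * + 1)) * (Y * Y - Q) - (P * (P * + 1) - + 4) * (Q - + 1)
  collect = solve-∀

cross-multiply : ∀ (t m n₁ n₂ : ℤ) (d : ℕ) → + d * t ≡ + d * m + n₁ - n₂ →
                 t * + (1 ℕ.* (d ℕ.* d)) ≡ (m * + (d ℕ.* d) + (n₁ * + d + - n₂ * + d) * + 1) * + 1
cross-multiply t m n₁ n₂ d eq = begin
  t * + (1 ℕ.* (d ℕ.* d))                                ≡⟨ cong (λ n → t * + n) (ℕP.*-identityˡ (d ℕ.* d)) ⟩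
  t * + (d ℕ.* d)                                        ≡⟨ cong (t *_) (ℤP.pos-* d d) ⟩
  t * (+ d * + d)                                        ≡⟨ regroup t (+ d) ⟩
  + d * (+ d * t)                                        ≡⟨ cong (+ d *_) eq ⟩
  + d * (+ d * m + n₁ - n₂)                              ≡⟨ expand (+ d) m n₁ n₂ ⟩
  (m * (+ d * + d) + (n₁ * + d + - n₂ * + d) * + 1) * + 1 ≡⟨ cong (λ z → (m * z + (n₁ * + d + - n₂ * + d) * + 1) * + 1) (ℤP.pos-* d d) ⟨
  (m * + (d ℕ.* d) + (n₁ * + d + - n₂ * + d) * + 1) * + 1 ∎
  where
  open ≡-Reasoning
  regroup : ∀ t d → t * (d * d) ≡ d * (d * t)
  regroup = solve-∀
  expand : ∀ d m n₁ n₂ → d * (d * m + n₁ - n₂) ≡ (m * (d * d) + (n₁ * d + - n₂ * d) * + 1) * + 1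
  expand = solve-∀

clear-denominator : ∀ (t m n₁ n₂ : ℤ) (k : ℕ) → + suc k * t ≡ + suc k * m + n₁ - n₂ →
                    t / 1 ≡ m / 1 ℚ.+ (n₁ / suc k ℚ.- n₂ / suc k)
clear-denominator t m n₁ n₂ k eq = ℚP.toℚᵘ-injective (begin
  toℚᵘ (t / 1)                                                    ≈⟨ ℚP.toℚᵘ-fromℚᵘ (mkℚᵘ t 0) ⟩
  mkℚᵘ t 0                                                        ≈⟨ ℚᵘ.*≡* (cross-multiply t m n₁ n₂ (suc k) eq) ⟩
  mkℚᵘ m 0 ℚᵘ.+ (mkℚᵘ n₁ k ℚᵘ.- mkℚᵘ n₂ k)                        ≈⟨ ℚᵘP.+-cong (ℚP.toℚᵘ-fromℚᵘ (mkℚᵘ m 0))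
                                                                       (ℚᵘP.+-cong (ℚP.toℚᵘ-fromℚᵘ (mkℚᵘ n₁ k))
                                                                         (ℚᵘP.≃-trans (ℚP.toℚᵘ-homo‿- (n₂ / suc k)) (ℚᵘP.-‿cong (ℚP.toℚᵘ-fromℚᵘ (mkℚᵘ n₂ k))))) ⟨
  toℚᵘ (m / 1) ℚᵘ.+ (toℚᵘ (n₁ / suc k) ℚᵘ.+ toℚᵘ (ℚ.- (n₂ / suc k))) ≈⟨ ℚᵘP.+-congʳ (toℚᵘ (m / 1)) (ℚP.toℚᵘ-homo-+ (n₁ / suc k) (ℚ.- (n₂ / suc k))) ⟨
  toℚᵘ (m / 1) ℚᵘ.+ toℚᵘ (n₁ / suc k ℚ.- n₂ / suc k)                 ≈⟨ ℚP.toℚᵘ-homo-+ (m / 1) (n₁ / suc k ℚ.- n₂ / suc k) ⟨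
  toℚᵘ (m / 1 ℚ.+ (n₁ / suc k ℚ.- n₂ / suc k))                     ∎)
  where open ℚᵘP.≃-Reasoning

module _ (p : ℕ) (p-prime : Prime p) where

  private
    instance
      p≢0 : ℕ.NonZero p
      p≢0 = prime⇒nonZero p-prime
    variable
      i j k l m n : ℤ

  -- Arithmetic modulo p

  infix 4 _≈_ _≉_ _≈?_

  record _≈_ (i j : ℤ) : Set where
    constructor mk≈
    field ≈⇒≡[mod] : i ≡ j [mod p ]
  open _≈_

  _≉_ : ℤ → ℤ → Set
  i ≉ j = ¬ (i ≈ j)

  opaque
    _≈?_ : (i j : ℤ) → Dec (i ≈ j)
    i ≈? j = map′ mk≈ ≈⇒≡[mod] (i ≡? j [mod p ])

  ≈-by : (k : ℤ) → i - j ≡ k * + p → i ≈ j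
  ≈-by k eq = mk≈ (S.∣⇒∣ᵤ (subst (+ p S.∣_) (sym eq) (S.∣n⇒∣m*n k S.∣-refl)))

  ≈-lin : (a b : ℤ) → i - j ≡ a * (k - l) + b * (m - n) → k ≈ l → m ≈ n → i ≈ j
  ≈-lin a b eq (mk≈ k≈l) (mk≈ m≈n) = mk≈ (S.∣⇒∣ᵤ (subst (+ p S.∣_) (sym eq)
    (S.∣m∣n⇒∣m+n (S.∣n⇒∣m*n a (S.∣ᵤ⇒∣ k≈l)) (S.∣n⇒∣m*n b (S.∣ᵤ⇒∣ m≈n)))))

  ≈-scale : (a : ℤ) → i - j ≡ a * (k - l) → k ≈ l → i ≈ j
  ≈-scale a eq (mk≈ k≈l) = mk≈ (S.∣⇒∣ᵤ (subst (+ p S.∣_) (sym eq) (S.∣n⇒∣m*n a (S.∣ᵤ⇒∣ k≈l))))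

  ≈-reflexive : i ≡ j → i ≈ j
  ≈-reflexive {i} refl = ≈-by 0ℤ (ℤP.+-inverseʳ i)

  ≈-refl : i ≈ i
  ≈-refl = ≈-reflexive refl

  ≈-sym : i ≈ j → j ≈ i
  ≈-sym {i} {j} = ≈-scale (- 1ℤ) (identity i j)
    where identity : ∀ i j → j - i ≡ - 1ℤ * (i - j)
          identity = solve-∀

  ≈-trans : i ≈ j → j ≈ k → i ≈ k
  ≈-trans {i} {j} {k} = ≈-lin 1ℤ 1ℤ (identity i j k)
    where identity : ∀ i j k → i - k ≡ 1ℤ * (i - j) + 1ℤ * (j - k)
          identity = solve-∀

  +-cong : i ≈ j → k ≈ l → i + k ≈ j + l
  +-cong {i} {j} {k} {l} = ≈-lin 1ℤ 1ℤ (identity i j k l)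
    where identity : ∀ i j k l → i + k - (j + l) ≡ 1ℤ * (i - j) + 1ℤ * (k - l)
          identity = solve-∀

  *-cong : i ≈ j → k ≈ l → i * k ≈ j * l
  *-cong {i} {j} {k} {l} = ≈-lin k j (identity i j k l)
    where identity : ∀ i j k l → i * k - j * l ≡ k * (i - j) + j * (k - l)
          identity = solve-∀

  -‿cong : i ≈ j → - i ≈ - j
  -‿cong {i} {j} = ≈-scale (- 1ℤ) (identity i j)
    where identity : ∀ i j → - i - - j ≡ - 1ℤ * (i - j)
          identity = solve-∀

  ≈-setoid : Setoid 0ℓ 0ℓ
  ≈-setoid = record
    { Carrier = ℤ ; _≈_ = _≈_
    ; isEquivalence = record { refl = ≈-refl ; sym = ≈-sym ; trans = ≈-trans } }

  minus-cong : i ≈ j → k ≈ l → i - k ≈ j - l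
  minus-cong i≈j k≈l = +-cong i≈j (-‿cong k≈l)

  ≈⇒-≈0 : i ≈ j → i - j ≈ 0ℤ
  ≈⇒-≈0 {i} {j} (mk≈ i≈j) = mk≈ (subst (λ k → + p ℤD.∣ k) (sym (ℤP.+-identityʳ (i - j))) i≈j)

  -≈0⇒≈ : i - j ≈ 0ℤ → i ≈ j
  -≈0⇒≈ {i} {j} (mk≈ d) = mk≈ (subst (λ k → + p ℤD.∣ k) (ℤP.+-identityʳ (i - j)) d)

  ≈0⇒∣ : i ≈ 0ℤ → p ℕD.∣ ∣ i ∣
  ≈0⇒∣ {i} (mk≈ d) = subst (λ k → p ℕD.∣ ∣ k ∣) (ℤP.+-identityʳ i) d

  ∣⇒≈0 : p ℕD.∣ ∣ i ∣ → i ≈ 0ℤ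
  ∣⇒≈0 {i} d = mk≈ (subst (λ k → p ℕD.∣ ∣ k ∣) (sym (ℤP.+-identityʳ i)) d)

  *-≈0 : i * j ≈ 0ℤ → i ≈ 0ℤ ⊎ j ≈ 0ℤ
  *-≈0 {i} {j} ij≈0 =
    Sum.map ∣⇒≈0 ∣⇒≈0 (euclidsLemma ∣ i ∣ ∣ j ∣ p-prime (subst (p ℕD.∣_) (ℤP.abs-* i j) (≈0⇒∣ ij≈0)))

  *-≉0 : i ≉ 0ℤ → j ≉ 0ℤ → i * j ≉ 0ℤ
  *-≉0 i≉0 j≉0 ij≈0 = Sum.[ i≉0 , j≉0 ] (*-≈0 ij≈0)

  *-cancelˡ-≈ : k ≉ 0ℤ → k * i ≈ k * j → i ≈ j
  *-cancelˡ-≈ {k} {i} {j} k≉0 ki≈kj =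
    -≈0⇒≈ (Sum.[ (λ k≈0 → ⊥-elim (k≉0 k≈0)) , id ]
      (*-≈0 (≈-trans (≈-reflexive (distrib k i j)) (≈⇒-≈0 ki≈kj))))
    where distrib : ∀ k i j → k * (i - j) ≡ k * i - k * j
          distrib = solve-∀

  %-≈ : ∀ i → i ≈ + (i %ℕ p)
  %-≈ i = ≈-by (i /ℕ p) (begin
    i - + (i %ℕ p)                              ≡⟨ cong (_- + (i %ℕ p)) (a≡a%ℕn+[a/ℕn]*n i p) ⟩
    + (i %ℕ p) + (i /ℕ p) * + p - + (i %ℕ p)    ≡⟨ cancel (+ (i %ℕ p)) ((i /ℕ p) * + p) ⟩
    (i /ℕ p) * + p                              ∎)
    where open ≡-Reasoning
          cancel : ∀ r k → r + k - r ≡ k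
          cancel = solve-∀

  +-≈-injective : ∀ {x y} → x ℕ.< p → y ℕ.< p → + x ≈ + y → x ≡ y
  +-≈-injective {x} {y} x<p y<p (mk≈ p∣x-y) =
    ℤP.+-injective (ℤP.i-j≡0⇒i≡j (+ x) (+ y) (ℤP.∣i∣≡0⇒i≡0 (∣∧<⇒≡0 p∣x-y ∣x-y∣<p)))
    where ∣x-y∣<p : ∣ + x - + y ∣ ℕ.< p
          ∣x-y∣<p = subst (ℕ._< p) (cong ∣_∣ (sym (ℤP.[+m]-[+n]≡m⊖n x y)))
                      (ℕP.≤-<-trans (ℤP.∣m⊝n∣≤m⊔n x y) (ℕP.⊔-lub x<p y<p))

  private
    natural-inverse : ∀ {n} → ℕ.NonZero n → n ℕ.< p → ∃ λ b → + n * b ≈ 1ℤ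
    natural-inverse {n} n≢0 n<p with coprime-Bézout (prime⇒coprime p-prime {{n≢0}} n<p)
    ... | Bézout.+- x y eq = - + y , ≈-by (- + x) (begin
      + n * - + y - 1ℤ      ≡⟨ rearrange (+ n) (+ y) ⟩
      - (1ℤ + + y * + n)    ≡⟨ cong -_ (1+*≡*⇒ℤ y n x p eq) ⟩
      - (+ x * + p)         ≡⟨ ℤP.neg-distribˡ-* (+ x) (+ p) ⟩
      - + x * + p           ∎)
      where open ≡-Reasoning
            rearrange : ∀ n y → n * - y - 1ℤ ≡ - (1ℤ + y * n)
            rearrange = solve-∀
    ... | Bézout.-+ x y eq = + y , ≈-by (+ x) (begin
      + n * + y - 1ℤ             ≡⟨ cong (_- 1ℤ) (ℤP.*-comm (+ n) (+ y)) ⟩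
      + y * + n - 1ℤ             ≡⟨ cong (_- 1ℤ) (1+*≡*⇒ℤ x p y n eq) ⟨
      1ℤ + + x * + p - 1ℤ        ≡⟨ cancel (+ x * + p) ⟩
      + x * + p                  ∎)
      where open ≡-Reasoning
            cancel : ∀ k → 1ℤ + k - 1ℤ ≡ k
            cancel = solve-∀

    inverse : i ≉ 0ℤ → ∃ λ b → i * b ≈ 1ℤ
    inverse {i} i≉0 with i %ℕ p in eq
    ... | zero  = ⊥-elim (i≉0 (subst (λ r → i ≈ + r) eq (%-≈ i)))
    ... | suc r with natural-inverse {suc r} _ (subst (ℕ._< p) eq (n%ℕd<d i p))
    ...   | b , rb≈1 = b , ≈-trans (*-cong (subst (λ r → i ≈ + r) eq (%-≈ i)) ≈-refl) rb≈1

  -- 0 ⁻¹ = 0 is a junk value; only i ⁻¹ with i ≉ 0 is used.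
  infix 10 _⁻¹
  _⁻¹ : ℤ → ℤ
  i ⁻¹ with i ≈? 0ℤ
  ... | yes _   = 0ℤ
  ... | no i≉0  = proj₁ (inverse i≉0)

  *-inverseʳ : i ≉ 0ℤ → i * i ⁻¹ ≈ 1ℤ
  *-inverseʳ {i} i≉0 with i ≈? 0ℤ
  ... | yes i≈0  = ⊥-elim (i≉0 i≈0)
  ... | no i≉0′  = proj₂ (inverse i≉0′)

  *-inverseˡ : i ≉ 0ℤ → i ⁻¹ * i ≈ 1ℤ
  *-inverseˡ {i} i≉0 = ≈-trans (≈-reflexive (ℤP.*-comm (i ⁻¹) i)) (*-inverseʳ i≉0)

  module ≈-Reasoning = SetoidReasoning ≈-setoid

  1≉0 : 1ℤ ≉ 0ℤ
  1≉0 1≈0 = ℕP.<⇒≱ (nonTrivial⇒n>1 p {{prime⇒nonTrivial p-prime}}) (ℕD.∣⇒≤ (≈0⇒∣ 1≈0))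

  ⁻¹-≉0 : i ≉ 0ℤ → i ⁻¹ ≉ 0ℤ
  ⁻¹-≉0 {i} i≉0 i⁻¹≈0 = 1≉0 (begin
    1ℤ          ≈⟨ *-inverseʳ i≉0 ⟨
    i * i ⁻¹    ≈⟨ *-cong (≈-refl {i}) i⁻¹≈0 ⟩
    i * 0ℤ      ≡⟨ ℤP.*-zeroʳ i ⟩
    0ℤ          ∎)
    where open ≈-Reasoning

  *≈⇒≈*⁻¹ : k ≉ 0ℤ → i * k ≈ j → i ≈ j * k ⁻¹
  *≈⇒≈*⁻¹ {k} {i} {j} k≉0 ik≈j = begin
    i                ≡⟨ ℤP.*-identityʳ i ⟨
    i * 1ℤ           ≈⟨ *-cong (≈-refl {i}) (*-inverseʳ k≉0) ⟨
    i * (k * k ⁻¹)   ≡⟨ ℤP.*-assoc i k (k ⁻¹) ⟨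
    i * k * k ⁻¹     ≈⟨ *-cong ik≈j ≈-refl ⟩
    j * k ⁻¹         ∎
    where open ≈-Reasoning

  ≈*⁻¹⇒*≈ : k ≉ 0ℤ → i ≈ j * k ⁻¹ → i * k ≈ j
  ≈*⁻¹⇒*≈ {k} {i} {j} k≉0 i≈j/k = begin
    i * k            ≈⟨ *-cong i≈j/k ≈-refl ⟩
    j * k ⁻¹ * k     ≡⟨ ℤP.*-assoc j (k ⁻¹) k ⟩
    j * (k ⁻¹ * k)   ≈⟨ *-cong (≈-refl {j}) (*-inverseˡ k≉0) ⟩
    j * 1ℤ           ≡⟨ ℤP.*-identityʳ j ⟩
    j                ∎
    where open ≈-Reasoning

  𝟙≉0 : ℤ → ℕ
  𝟙≉0 i = 𝟙 (¬? (i ≈? 0ℤ))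

  𝟙≉0-⇔ : (i ≈ 0ℤ → j ≈ 0ℤ) → (j ≈ 0ℤ → i ≈ 0ℤ) → 𝟙≉0 i ≡ 𝟙≉0 j
  𝟙≉0-⇔ {i} {j} to from = 𝟙-⇔ (¬? (i ≈? 0ℤ)) (¬? (j ≈? 0ℤ)) (λ i≉0 → i≉0 ∘ from) (λ j≉0 → j≉0 ∘ to)

  𝟙≉0-cong : i ≈ j → 𝟙≉0 i ≡ 𝟙≉0 j
  𝟙≉0-cong i≈j = 𝟙≉0-⇔ (≈-trans (≈-sym i≈j)) (≈-trans i≈j)

  𝟙≉0-≉0 : i ≉ 0ℤ → 𝟙≉0 i ≡ 1
  𝟙≉0-≉0 {i} = 𝟙-yes (¬? (i ≈? 0ℤ))

  𝟙≉0-≈0 : i ≈ 0ℤ → 𝟙≉0 i ≡ 0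
  𝟙≉0-≈0 {i} i≈0 = 𝟙-no (¬? (i ≈? 0ℤ)) (λ i≉0 → i≉0 i≈0)

  𝟙≉0-idem : ∀ i → 𝟙≉0 i ℕ.* 𝟙≉0 i ≡ 𝟙≉0 i
  𝟙≉0-idem i = 𝟙-idem (¬? (i ≈? 0ℤ))

  𝟙≉0-* : ∀ i j → 𝟙≉0 (i * j) ≡ 𝟙≉0 i ℕ.* 𝟙≉0 j
  𝟙≉0-* i j with i ≈? 0ℤ | j ≈? 0ℤ
  ... | yes i≈0 | _       = 𝟙≉0-≈0 (≈-trans (*-cong i≈0 ≈-refl) (≈-reflexive (ℤP.*-zeroˡ j)))
  ... | no _    | yes j≈0 = 𝟙≉0-≈0 (≈-trans (*-cong (≈-refl {i}) j≈0) (≈-reflexive (ℤP.*-zeroʳ i)))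
  ... | no i≉0  | no j≉0  = 𝟙≉0-≉0 (*-≉0 i≉0 j≉0)

  𝟙≉0-*-≉0 : k ≉ 0ℤ → 𝟙≉0 (i * k) ≡ 𝟙≉0 i
  𝟙≉0-*-≉0 {k} {i} k≉0 = trans (𝟙≉0-* i k) (trans (cong (𝟙≉0 i ℕ.*_) (𝟙≉0-≉0 k≉0)) (ℕP.*-identityʳ _))

  -‿≈0 : - i ≈ 0ℤ → i ≈ 0ℤ
  -‿≈0 {i} -i≈0 = ≈-trans (≈-reflexive (sym (ℤP.neg-involutive i))) (-‿cong -i≈0)

  -‿≉0 : i ≉ 0ℤ → - i ≉ 0ℤ
  -‿≉0 i≉0 = i≉0 ∘ -‿≈0

  𝟙≉0-neg : ∀ i → 𝟙≉0 (- i) ≡ 𝟙≉0 i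
  𝟙≉0-neg i = 𝟙≉0-⇔ -‿≈0 -‿cong

  𝟙≉0-swap : ∀ i j → 𝟙≉0 (i - j) ≡ 𝟙≉0 (j - i)
  𝟙≉0-swap i j = trans (cong 𝟙≉0 (negate i j)) (𝟙≉0-neg (j - i))
    where negate : ∀ i j → i - j ≡ - (j - i)
          negate = solve-∀

  𝟙≉0[-]≡𝟙≉ : ∀ i j → 𝟙≉0 (i - j) ≡ 𝟙 (¬? (i ≈? j))
  𝟙≉0[-]≡𝟙≉ i j = 𝟙-⇔ (¬? (i - j ≈? 0ℤ)) (¬? (i ≈? j)) (λ ≉0 → ≉0 ∘ ≈⇒-≈0) (λ ≉ → ≉ ∘ -≈0⇒≈)

  𝟙≈+𝟙≉0 : ∀ i j → 𝟙 (i ≈? j) ℕ.+ 𝟙≉0 (i - j) ≡ 1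
  𝟙≈+𝟙≉0 i j = trans (ℕP.+-comm (𝟙 (i ≈? j)) _) (trans (cong (ℕ._+ 𝟙 (i ≈? j)) (𝟙≉0[-]≡𝟙≉ i j)) (𝟙-¬ (i ≈? j)))

  𝟙≈-cong : i ≈ k → j ≈ l → 𝟙 (i ≈? j) ≡ 𝟙 (k ≈? l)
  𝟙≈-cong {i} {k} {j} {l} i≈k j≈l = 𝟙-⇔ (i ≈? j) (k ≈? l) (λ i≈j → ≈-trans (≈-sym i≈k) (≈-trans i≈j j≈l))
                            (λ k≈l → ≈-trans i≈k (≈-trans k≈l (≈-sym j≈l)))

  -- Counting over the units 1, …, p − 1

  U : List ℕ
  U = List.map suc (upTo (p ∸ 1))

  U-< : All (ℕ._< p) U
  U-< = AllP.map⁺ (AllP.applyUpTo⁺₁ id (p ∸ 1) <∸1⇒suc<)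

  suc<⇒≉0 : ∀ {x} → suc x ℕ.< p → + suc x ≉ 0ℤ
  suc<⇒≉0 x<p x≈0 = ℕP.<⇒≱ x<p (ℕD.∣⇒≤ (≈0⇒∣ x≈0))

  U-≉0 : All (λ x → + x ≉ 0ℤ) U
  U-≉0 = AllP.map⁺ (AllP.applyUpTo⁺₁ id (p ∸ 1) (suc<⇒≉0 ∘ <∸1⇒suc<))

  length-U : length U ≡ p ∸ 1
  length-U = trans (LP.length-map suc (upTo (p ∸ 1))) (LP.length-upTo (p ∸ 1))

  ∑U-𝟙≈ : ∀ t → ∑ U (λ x → 𝟙 (+ x ≈? t)) ≡ 𝟙≉0 t
  ∑U-𝟙≈ t = trans (∑-congᴬ U-< λ x x<p → 𝟙-⇔ (+ x ≈? t) (x ≟ r)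
                     (λ x≈t → +-≈-injective x<p r<p (≈-trans x≈t t≈r)) (λ { refl → ≈-sym t≈r }))
                   (trans (∑-map suc (upTo (p ∸ 1)) (λ x → 𝟙 (x ≟ r))) (count r t≈r r<p))
    where
    r = t %ℕ p
    t≈r = %-≈ t
    r<p = n%ℕd<d t p
    count : ∀ r → t ≈ + r → r ℕ.< p → ∑ (upTo (p ∸ 1)) (λ i → 𝟙 (suc i ≟ r)) ≡ 𝟙≉0 t
    count zero    t≈0 _   = trans (∑-zero (upTo (p ∸ 1))) (sym (𝟙≉0-≈0 t≈0))
    count (suc r) t≈r r<p = begin
      ∑ (upTo (p ∸ 1)) (λ i → 𝟙 (i ≟ r))  ≡⟨ ∑-upTo-𝟙≟ (p ∸ 1) r ⟩
      𝟙 (r ℕ.<? p ∸ 1)                    ≡⟨ 𝟙-yes (r ℕ.<? p ∸ 1) (suc<⇒<∸1 r<p) ⟩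
      1                                   ≡⟨ 𝟙≉0-≉0 (λ t≈0 → suc<⇒≉0 r<p (≈-trans (≈-sym t≈r) t≈0)) ⟨
      𝟙≉0 t                               ∎
      where open ≡-Reasoning

  ∑U-𝟙≈-weighted : (h : ℤ → ℕ) → h Preserves _≈_ ⟶ _≡_ → ∀ t →
                   ∑ U (λ x → h (+ x) ℕ.* 𝟙 (+ x ≈? t)) ≡ h t ℕ.* 𝟙≉0 t
  ∑U-𝟙≈-weighted h h-cong t = begin
    ∑ U (λ x → h (+ x) ℕ.* 𝟙 (+ x ≈? t)) ≡⟨ ∑-cong U (λ x → evaluate (+ x ≈? t)) ⟩
    ∑ U (λ x → h t ℕ.* 𝟙 (+ x ≈? t))     ≡⟨ ∑-*ˡ U (h t) _ ⟩
    h t ℕ.* ∑ U (λ x → 𝟙 (+ x ≈? t))     ≡⟨ cong (h t ℕ.*_) (∑U-𝟙≈ t) ⟩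
    h t ℕ.* 𝟙≉0 t                        ∎
    where
    open ≡-Reasoning
    evaluate : ∀ {x} (d : Dec (x ≈ t)) → h x ℕ.* 𝟙 d ≡ h t ℕ.* 𝟙 d
    evaluate (yes x≈t) = cong (ℕ._* 1) (h-cong x≈t)
    evaluate {x} (no _) = trans (ℕP.*-zeroʳ (h x)) (sym (ℕP.*-zeroʳ (h t)))

  ∑U-𝟙≉0[x-1] : ∑ U (λ x → 𝟙≉0 (+ x - 1ℤ)) ≡ p ∸ 2
  ∑U-𝟙≉0[x-1] = begin
    ∑≉1                ≡⟨ ℕP.m+n∸n≡m ∑≉1 1 ⟨
    ∑≉1 ℕ.+ 1 ∸ 1      ≡⟨ cong (_∸ 1) ∑≉1+1 ⟩
    p ∸ 1 ∸ 1          ≡⟨ ℕP.∸-+-assoc p 1 1 ⟩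
    p ∸ 2              ∎
    where
    open ≡-Reasoning
    ∑≉1 = ∑ U (λ x → 𝟙≉0 (+ x - 1ℤ))
    ∑≉1+1 : ∑≉1 ℕ.+ 1 ≡ p ∸ 1
    ∑≉1+1 = begin
      ∑≉1 ℕ.+ 1                                               ≡⟨ cong (∑≉1 ℕ.+_) (trans (sym (𝟙≉0-≉0 1≉0)) (sym (∑U-𝟙≈ 1ℤ))) ⟩
      ∑≉1 ℕ.+ ∑ U (λ x → 𝟙 (+ x ≈? 1ℤ))                       ≡⟨ ∑-+ U (λ x → 𝟙≉0 (+ x - 1ℤ)) (λ x → 𝟙 (+ x ≈? 1ℤ)) ⟨
      ∑ U (λ x → 𝟙≉0 (+ x - 1ℤ) ℕ.+ 𝟙 (+ x ≈? 1ℤ))            ≡⟨ ∑-cong U (λ x → trans (ℕP.+-comm (𝟙≉0 (+ x - 1ℤ)) _) (𝟙≈+𝟙≉0 (+ x) 1ℤ)) ⟩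
      ∑ U (λ _ → 1)                                           ≡⟨ trans (∑-const U 1) (trans (ℕP.*-identityʳ _) length-U) ⟩
      p ∸ 1                                                   ∎

  -- For u ≉ 0 the only solution is x = v u⁻¹, a unit ≠ 1 exactly when v ≉ 0 and v ≉ u.
  ∑U-linear : ∀ {u v} → u ≉ 0ℤ ⊎ v ≉ 0ℤ →
              ∑ U (λ x → 𝟙≉0 (+ x - 1ℤ) ℕ.* 𝟙 (+ x * u ≈? v)) ≡ 𝟙≉0 u ℕ.* 𝟙≉0 v ℕ.* 𝟙≉0 (v - u)
  ∑U-linear {u} {v} u≉0∨v≉0 = by-cases (u ≈? 0ℤ)
    where
    by-cases : Dec (u ≈ 0ℤ) → ∑ U (λ x → 𝟙≉0 (+ x - 1ℤ) ℕ.* 𝟙 (+ x * u ≈? v)) ≡ 𝟙≉0 u ℕ.* 𝟙≉0 v ℕ.* 𝟙≉0 (v - u)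
    by-cases (yes u≈0) = begin
      ∑ U (λ x → 𝟙≉0 (+ x - 1ℤ) ℕ.* 𝟙 (+ x * u ≈? v))   ≡⟨ ∑-cong U (λ x → cong (𝟙≉0 (+ x - 1ℤ) ℕ.*_) (𝟙-no (+ x * u ≈? v) (no-solution x))) ⟩
      ∑ U (λ x → 𝟙≉0 (+ x - 1ℤ) ℕ.* 0)                  ≡⟨ ∑-cong U (λ x → ℕP.*-zeroʳ (𝟙≉0 (+ x - 1ℤ))) ⟩
      ∑ U (λ _ → 0)                                     ≡⟨ ∑-zero U ⟩
      0                                                 ≡⟨ cong (λ n → n ℕ.* 𝟙≉0 v ℕ.* 𝟙≉0 (v - u)) (𝟙≉0-≈0 u≈0) ⟨
      𝟙≉0 u ℕ.* 𝟙≉0 v ℕ.* 𝟙≉0 (v - u)                   ∎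
      where
      open ≡-Reasoning
      no-solution : ∀ x → + x * u ≉ v
      no-solution x xu≈v = Sum.[ (λ u≉0 → u≉0 u≈0) , (λ v≉0 → v≉0 v≈0) ] u≉0∨v≉0
        where v≈0 = ≈-trans (≈-sym xu≈v) (≈-trans (*-cong (≈-refl {+ x}) u≈0) (≈-reflexive (ℤP.*-zeroʳ (+ x))))
    by-cases (no u≉0) = begin
      ∑ U (λ x → 𝟙≉0 (+ x - 1ℤ) ℕ.* 𝟙 (+ x * u ≈? v))         ≡⟨ ∑-cong U (λ x → cong (𝟙≉0 (+ x - 1ℤ) ℕ.*_)
                                                                   (𝟙-⇔ (+ x * u ≈? v) (+ x ≈? t) (*≈⇒≈*⁻¹ u≉0) (≈*⁻¹⇒*≈ u≉0))) ⟩
      ∑ U (λ x → 𝟙≉0 (+ x - 1ℤ) ℕ.* 𝟙 (+ x ≈? t))             ≡⟨ ∑U-𝟙≈-weighted (λ z → 𝟙≉0 (z - 1ℤ)) (λ i≈j → 𝟙≉0-cong (minus-cong i≈j (≈-refl {1ℤ}))) t ⟩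
      𝟙≉0 (t - 1ℤ) ℕ.* 𝟙≉0 t                                  ≡⟨ cong₂ ℕ._*_ (trans (sym (𝟙≉0-*-≉0 u≉0)) (𝟙≉0-cong [t-1]u≈v-u)) (𝟙≉0-*-≉0 (⁻¹-≉0 u≉0)) ⟩
      𝟙≉0 (v - u) ℕ.* 𝟙≉0 v                                   ≡⟨ ℕP.*-comm (𝟙≉0 (v - u)) (𝟙≉0 v) ⟩
      𝟙≉0 v ℕ.* 𝟙≉0 (v - u)                                   ≡⟨ cong (ℕ._* 𝟙≉0 (v - u)) (ℕP.*-identityˡ (𝟙≉0 v)) ⟨
      1 ℕ.* 𝟙≉0 v ℕ.* 𝟙≉0 (v - u)                             ≡⟨ cong (λ n → n ℕ.* 𝟙≉0 v ℕ.* 𝟙≉0 (v - u)) (𝟙≉0-≉0 u≉0) ⟨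
      𝟙≉0 u ℕ.* 𝟙≉0 v ℕ.* 𝟙≉0 (v - u)                         ∎
      where
      open ≡-Reasoning
      t = v * u ⁻¹
      [t-1]u≈v-u : (t - 1ℤ) * u ≈ v - u
      [t-1]u≈v-u = ≈-trans (≈-reflexive (expand v (u ⁻¹) u)) (minus-cong (≈*⁻¹⇒*≈ {j = v} u≉0 (≈-refl {t})) (≈-refl {u}))
        where expand : ∀ v w u → (v * w - 1ℤ) * u ≡ v * w * u - u
              expand = solve-∀

  ∑U-avoid : ∀ {u v} → u ≉ 0ℤ ⊎ v ≉ 0ℤ →
             ∑ U (λ y → 𝟙≉0 (+ y - 1ℤ) ℕ.* 𝟙≉0 (+ y * u - v)) ℕ.+ 𝟙≉0 u ℕ.* 𝟙≉0 v ℕ.* 𝟙≉0 (v - u) ≡ p ∸ 2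
  ∑U-avoid {u} {v} u≉0∨v≉0 = begin
    ∑ U (λ y → h y ℕ.* 𝟙≉0 (+ y * u - v)) ℕ.+ 𝟙≉0 u ℕ.* 𝟙≉0 v ℕ.* 𝟙≉0 (v - u)
      ≡⟨ cong (∑ U (λ y → h y ℕ.* 𝟙≉0 (+ y * u - v)) ℕ.+_) (∑U-linear u≉0∨v≉0) ⟨
    ∑ U (λ y → h y ℕ.* 𝟙≉0 (+ y * u - v)) ℕ.+ ∑ U (λ y → h y ℕ.* 𝟙 (+ y * u ≈? v))
      ≡⟨ ∑-+ U _ _ ⟨
    ∑ U (λ y → h y ℕ.* 𝟙≉0 (+ y * u - v) ℕ.+ h y ℕ.* 𝟙 (+ y * u ≈? v))
      ≡⟨ ∑-cong U (λ y → trans (sym (ℕP.*-distribˡ-+ (h y) _ _))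
                         (trans (cong (h y ℕ.*_) (trans (ℕP.+-comm (𝟙≉0 (+ y * u - v)) _) (𝟙≈+𝟙≉0 (+ y * u) v))) (ℕP.*-identityʳ (h y)))) ⟩
    ∑ U h
      ≡⟨ ∑U-𝟙≉0[x-1] ⟩
    p ∸ 2 ∎
    where
    open ≡-Reasoning
    h : ℕ → ℕ
    h y = 𝟙≉0 (+ y - 1ℤ)

  ≈-transport : i - j ≡ k - l → i ≈ j → k ≈ l
  ≈-transport eq i≈j = -≈0⇒≈ (subst (_≈ 0ℤ) eq (≈⇒-≈0 i≈j))

  𝟙≈-transport : i - j ≡ k - l → 𝟙 (i ≈? j) ≡ 𝟙 (k ≈? l)
  𝟙≈-transport {i} {j} {k} {l} eq = 𝟙-⇔ (i ≈? j) (k ≈? l) (≈-transport eq) (≈-transport (sym eq))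

  𝟙≉0-scale : k ≉ 0ℤ → i * k ≈ j → 𝟙≉0 i ≡ 𝟙≉0 j
  𝟙≉0-scale k≉0 ik≈j = trans (sym (𝟙≉0-*-≉0 k≉0)) (𝟙≉0-cong ik≈j)

  𝟙≉0²-≉0 : i ≉ 0ℤ → j ≉ 0ℤ → ∀ n → 𝟙≉0 i ℕ.* 𝟙≉0 j ℕ.* n ≡ n
  𝟙≉0²-≉0 i≉0 j≉0 n rewrite 𝟙≉0-≉0 i≉0 | 𝟙≉0-≉0 j≉0 = ℕP.*-identityˡ n

  -- Appending one coordinate to both tuples

  ∑∑≉1 : (ℕ → ℕ → ℕ) → ℕ
  ∑∑≉1 F = ∑ U λ x → ∑ U λ y → 𝟙≉0 (+ x - 1ℤ) ℕ.* 𝟙≉0 (+ y - 1ℤ) ℕ.* F x y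

  ∑∑≉1-inner : ∀ F → ∑∑≉1 F ≡ ∑ U λ y → 𝟙≉0 (+ y - 1ℤ) ℕ.* ∑ U (λ x → 𝟙≉0 (+ x - 1ℤ) ℕ.* F x y)
  ∑∑≉1-inner F = trans (∑-comm U U (λ x y → 𝟙≉0 (+ x - 1ℤ) ℕ.* 𝟙≉0 (+ y - 1ℤ) ℕ.* F x y)) (∑-cong U λ y →
    trans (∑-cong U (λ x → rearrange (𝟙≉0 (+ x - 1ℤ)) (𝟙≉0 (+ y - 1ℤ)) (F x y))) (∑-*ˡ U (𝟙≉0 (+ y - 1ℤ)) (λ x → 𝟙≉0 (+ x - 1ℤ) ℕ.* F x y)))
    where rearrange : ∀ a b c → a ℕ.* b ℕ.* c ≡ b ℕ.* (a ℕ.* c)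
          rearrange a b c = trans (cong (ℕ._* c) (ℕP.*-comm a b)) (ℕP.*-assoc b a c)

  ∑∑≉1-avoid : ∀ {u v} F → u ≉ 0ℤ ⊎ v ≉ 0ℤ →
    (∀ y → + y ≉ 0ℤ → + y - 1ℤ ≉ 0ℤ → ∑ U (λ x → 𝟙≉0 (+ x - 1ℤ) ℕ.* F x y) ≡ 𝟙≉0 (+ y * u - v)) →
    ∑∑≉1 F ℕ.+ 𝟙≉0 u ℕ.* 𝟙≉0 v ℕ.* 𝟙≉0 (v - u) ≡ p ∸ 2
  ∑∑≉1-avoid {u} {v} F u≉0∨v≉0 inner =
    trans (cong (ℕ._+ _) (trans (∑∑≉1-inner F) (∑-congᴬ U-≉0 λ y y≉0 → on-y y (inner y y≉0) (+ y - 1ℤ ≈? 0ℤ))))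
          (∑U-avoid u≉0∨v≉0)
    where
    on-y : ∀ y → (+ y - 1ℤ ≉ 0ℤ → ∑ U (λ x → 𝟙≉0 (+ x - 1ℤ) ℕ.* F x y) ≡ 𝟙≉0 (+ y * u - v)) → Dec (+ y - 1ℤ ≈ 0ℤ) →
           𝟙≉0 (+ y - 1ℤ) ℕ.* ∑ U (λ x → 𝟙≉0 (+ x - 1ℤ) ℕ.* F x y) ≡ 𝟙≉0 (+ y - 1ℤ) ℕ.* 𝟙≉0 (+ y * u - v)
    on-y y _     (yes y≈1) rewrite 𝟙≉0-≈0 y≈1 = refl
    on-y y inner (no y≉1)  = cong (𝟙≉0 (+ y - 1ℤ) ℕ.*_) (inner y≉1)

  ∑∑≉1-∏≈ : ∀ {α β} → α ≉ 0ℤ → β ≉ 0ℤ →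
    ∑∑≉1 (λ x y → 𝟙 (+ x * α ≈? + y * β)) ℕ.+ 𝟙≉0 (α - β) ≡ p ∸ 2
  ∑∑≉1-∏≈ {α} {β} α≉0 β≉0 =
    trans (cong (∑∑≉1 F ℕ.+_) (sym (𝟙≉0²-≉0 β≉0 α≉0 _)))
          (∑∑≉1-avoid F (inj₁ β≉0) λ y y≉0 _ →
            trans (∑U-linear (inj₁ α≉0)) (𝟙≉0²-≉0 α≉0 (*-≉0 y≉0 β≉0) _))
    where F = λ x y → 𝟙 (+ x * α ≈? + y * β)

  ∑∑≉1-∏₋₁≈ : ∀ {α β} → α ≉ 0ℤ → β ≉ 0ℤ →
    ∑∑≉1 (λ x y → 𝟙 ((+ x - 1ℤ) * α ≈? (+ y - 1ℤ) * β)) ℕ.+ 𝟙≉0 (α - β) ≡ p ∸ 2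
  ∑∑≉1-∏₋₁≈ {α} {β} α≉0 β≉0 =
    trans (cong (∑∑≉1 F ℕ.+_) correction) (∑∑≉1-avoid F (inj₁ β≉0) inner)
    where
    F = λ x y → 𝟙 ((+ x - 1ℤ) * α ≈? (+ y - 1ℤ) * β)
    correction : 𝟙≉0 (α - β) ≡ 𝟙≉0 β ℕ.* 𝟙≉0 (β - α) ℕ.* 𝟙≉0 (β - α - β)
    correction = sym (trans (*-identityˡʳ _ (𝟙≉0-≉0 β≉0) β-α-β≉0) (𝟙≉0-swap β α))
      where β-α-β≉0 : 𝟙≉0 (β - α - β) ≡ 1
            β-α-β≉0 = trans (cong 𝟙≉0 (simplify α β)) (trans (𝟙≉0-neg α) (𝟙≉0-≉0 α≉0))
              where simplify : ∀ α β → β - α - β ≡ - α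
                    simplify = solve-∀
    inner : ∀ y → + y ≉ 0ℤ → + y - 1ℤ ≉ 0ℤ →
            ∑ U (λ x → 𝟙≉0 (+ x - 1ℤ) ℕ.* F x y) ≡ 𝟙≉0 (+ y * β - (β - α))
    inner y _ y≉1 = begin
      ∑ U (λ x → 𝟙≉0 (+ x - 1ℤ) ℕ.* F x y)                      ≡⟨ ∑-cong U (λ x → cong (𝟙≉0 (+ x - 1ℤ) ℕ.*_) (𝟙≈-transport (shift (+ x) (+ y) α β))) ⟩
      ∑ U (λ x → 𝟙≉0 (+ x - 1ℤ) ℕ.* 𝟙 (+ x * α ≈? v))           ≡⟨ ∑U-linear (inj₁ α≉0) ⟩
      𝟙≉0 α ℕ.* 𝟙≉0 v ℕ.* 𝟙≉0 (v - α)                           ≡⟨ *-identityˡʳ (𝟙≉0 v) (𝟙≉0-≉0 α≉0)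
                                                                     (trans (cong 𝟙≉0 (cancel (+ y - 1ℤ) α β)) (𝟙≉0-≉0 (*-≉0 y≉1 β≉0))) ⟩
      𝟙≉0 v                                                     ≡⟨ cong 𝟙≉0 (regroup (+ y) α β) ⟩
      𝟙≉0 (+ y * β - (β - α))                                   ∎
      where
      open ≡-Reasoning
      v = (+ y - 1ℤ) * β + α
      shift : ∀ x y α β → (x - 1ℤ) * α - (y - 1ℤ) * β ≡ x * α - ((y - 1ℤ) * β + α)
      shift = solve-∀
      cancel : ∀ w α β → w * β + α - α ≡ w * β
      cancel = solve-∀
      regroup : ∀ y α β → (y - 1ℤ) * β + α ≡ y * β - (β - α)
      regroup = solve-∀

  ∑∑≉1-ratio≈ : ∀ {a₁ b₁ a₂ b₂} → a₁ ≉ 0ℤ → b₁ ≉ 0ℤ → a₂ ≉ 0ℤ → b₂ ≉ 0ℤ →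
    ∑∑≉1 (λ x y → 𝟙 ((+ x * a₁) * ((+ y - 1ℤ) * b₂) ≈? (+ y * a₂) * ((+ x - 1ℤ) * b₁)))
      ℕ.+ 𝟙≉0 (a₁ * b₂ - a₂ * b₁) ≡ p ∸ 2
  ∑∑≉1-ratio≈ {a₁} {b₁} {a₂} {b₂} a₁≉0 b₁≉0 a₂≉0 b₂≉0 =
    trans (cong (∑∑≉1 F ℕ.+_) correction) (∑∑≉1-avoid F (inj₂ α≉0) inner)
    where
    α = a₁ * b₂
    β = a₂ * b₁
    α≉0 = *-≉0 a₁≉0 b₂≉0
    β≉0 = *-≉0 a₂≉0 b₁≉0
    F = λ x y → 𝟙 ((+ x * a₁) * ((+ y - 1ℤ) * b₂) ≈? (+ y * a₂) * ((+ x - 1ℤ) * b₁))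
    correction : 𝟙≉0 (α - β) ≡ 𝟙≉0 (α - β) ℕ.* 𝟙≉0 α ℕ.* 𝟙≉0 (α - (α - β))
    correction = sym (trans (ℕP.*-assoc (𝟙≉0 (α - β)) _ _)
      (trans (cong (𝟙≉0 (α - β) ℕ.*_) (trans (cong₂ ℕ._*_ (𝟙≉0-≉0 α≉0) (trans (cong 𝟙≉0 (simplify α β)) (𝟙≉0-≉0 β≉0))) refl))
             (ℕP.*-identityʳ _)))
      where simplify : ∀ α β → α - (α - β) ≡ β
            simplify = solve-∀
    inner : ∀ y → + y ≉ 0ℤ → + y - 1ℤ ≉ 0ℤ →
            ∑ U (λ x → 𝟙≉0 (+ x - 1ℤ) ℕ.* F x y) ≡ 𝟙≉0 (+ y * (α - β) - α)
    inner y y≉0 y≉1 = begin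
      ∑ U (λ x → 𝟙≉0 (+ x - 1ℤ) ℕ.* F x y)                   ≡⟨ ∑-cong U (λ x → cong (𝟙≉0 (+ x - 1ℤ) ℕ.*_) (𝟙≈-transport (shift (+ x) (+ y) a₁ b₁ a₂ b₂))) ⟩
      ∑ U (λ x → 𝟙≉0 (+ x - 1ℤ) ℕ.* 𝟙 (+ x * D ≈? - yβ))     ≡⟨ ∑U-linear (inj₂ -yβ≉0) ⟩
      𝟙≉0 D ℕ.* 𝟙≉0 (- yβ) ℕ.* 𝟙≉0 (- yβ - D)                ≡⟨ ℕP.*-assoc (𝟙≉0 D) _ _ ⟩
      𝟙≉0 D ℕ.* (𝟙≉0 (- yβ) ℕ.* 𝟙≉0 (- yβ - D))              ≡⟨ cong (𝟙≉0 D ℕ.*_) (cong₂ ℕ._*_ (𝟙≉0-≉0 -yβ≉0) -yβ-D≉0) ⟩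
      𝟙≉0 D ℕ.* 1                                            ≡⟨ ℕP.*-identityʳ (𝟙≉0 D) ⟩
      𝟙≉0 D                                                  ≡⟨ cong 𝟙≉0 (regroup (+ y) α β) ⟩
      𝟙≉0 (+ y * (α - β) - α)                                ∎
      where
      open ≡-Reasoning
      yβ = + y * β
      D = (+ y - 1ℤ) * α - yβ
      -yβ≉0 : - yβ ≉ 0ℤ
      -yβ≉0 = -‿≉0 (*-≉0 y≉0 β≉0)
      -yβ-D≉0 : 𝟙≉0 (- yβ - D) ≡ 1
      -yβ-D≉0 = trans (cong 𝟙≉0 (cancel (+ y) α yβ)) (𝟙≉0-≉0 (-‿≉0 (*-≉0 y≉1 α≉0)))
        where cancel : ∀ y α yβ → - yβ - ((y - 1ℤ) * α - yβ) ≡ - ((y - 1ℤ) * α)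
              cancel = solve-∀
      shift : ∀ x y a₁ b₁ a₂ b₂ → (x * a₁) * ((y - 1ℤ) * b₂) - (y * a₂) * ((x - 1ℤ) * b₁)
                                ≡ x * ((y - 1ℤ) * (a₁ * b₂) - y * (a₂ * b₁)) - - (y * (a₂ * b₁))
      shift = solve-∀
      regroup : ∀ y α β → (y - 1ℤ) * α - y * β ≡ y * (α - β) - α
      regroup = solve-∀

  *-≈0-≉0ʳ : k ≉ 0ℤ → i * k ≈ 0ℤ → i ≈ 0ℤ
  *-≈0-≉0ʳ {k} {i} k≉0 ik≈0 = Sum.[ id , (λ k≈0 → ⊥-elim (k≉0 k≈0)) ] (*-≈0 {i} {k} ik≈0)

  ∑U-both-inner : ∀ {a₁ b₁ a₂ b₂} y → a₁ ≉ 0ℤ → a₂ ≉ 0ℤ → + y ≉ 0ℤ →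
    ∑ U (λ x → 𝟙≉0 (+ x - 1ℤ) ℕ.* (𝟙 (+ x * a₁ ≈? + y * a₂) ℕ.* 𝟙 ((+ x - 1ℤ) * b₁ ≈? (+ y - 1ℤ) * b₂)))
      ≡ 𝟙≉0 (+ y * a₂ - a₁) ℕ.* 𝟙 (+ y * (a₂ * b₁ - a₁ * b₂) ≈? (b₁ - b₂) * a₁)
  ∑U-both-inner {a₁} {b₁} {a₂} {b₂} y a₁≉0 a₂≉0 y≉0 = begin
    ∑ U (λ x → 𝟙≉0 (+ x - 1ℤ) ℕ.* (𝟙 (+ x * a₁ ≈? ya₂) ℕ.* 𝟙 ((+ x - 1ℤ) * b₁ ≈? w)))
      ≡⟨ ∑-cong U (λ x → trans (rearrange (𝟙≉0 (+ x - 1ℤ)) _ _)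
                              (cong (g (+ x) ℕ.*_) (𝟙-⇔ (+ x * a₁ ≈? ya₂) (+ x ≈? t) (*≈⇒≈*⁻¹ a₁≉0) (≈*⁻¹⇒*≈ a₁≉0)))) ⟩
    ∑ U (λ x → g (+ x) ℕ.* 𝟙 (+ x ≈? t))
      ≡⟨ ∑U-𝟙≈-weighted g (λ i≈j → cong₂ ℕ._*_ (𝟙≉0-cong (minus-cong i≈j (≈-refl {1ℤ})))
                                                (𝟙≈-cong (*-cong (minus-cong i≈j (≈-refl {1ℤ})) (≈-refl {b₁})) (≈-refl {w}))) t ⟩
    g t ℕ.* 𝟙≉0 t
      ≡⟨ trans (cong (g t ℕ.*_) (𝟙≉0-≉0 (*-≉0 (*-≉0 y≉0 a₂≉0) (⁻¹-≉0 a₁≉0)))) (ℕP.*-identityʳ (g t)) ⟩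
    g t
      ≡⟨ cong₂ ℕ._*_ (𝟙≉0-scale a₁≉0 [t-1]a₁≈ya₂-a₁) equation-in-y ⟩
    𝟙≉0 (ya₂ - a₁) ℕ.* 𝟙 (+ y * (a₂ * b₁ - a₁ * b₂) ≈? (b₁ - b₂) * a₁) ∎
    where
    open ≡-Reasoning
    ya₂ = + y * a₂
    w = (+ y - 1ℤ) * b₂
    t = ya₂ * a₁ ⁻¹
    g : ℤ → ℕ
    g z = 𝟙≉0 (z - 1ℤ) ℕ.* 𝟙 ((z - 1ℤ) * b₁ ≈? w)
    rearrange : ∀ a b c → a ℕ.* (b ℕ.* c) ≡ a ℕ.* c ℕ.* b
    rearrange a b c = trans (cong (a ℕ.*_) (ℕP.*-comm b c)) (sym (ℕP.*-assoc a c b))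
    [t-1]a₁≈ya₂-a₁ : (t - 1ℤ) * a₁ ≈ ya₂ - a₁
    [t-1]a₁≈ya₂-a₁ = ≈-trans (≈-reflexive (expand t a₁)) (minus-cong (≈*⁻¹⇒*≈ {j = ya₂} a₁≉0 (≈-refl {t})) (≈-refl {a₁}))
      where expand : ∀ t a → (t - 1ℤ) * a ≡ t * a - a
            expand = solve-∀
    equation-in-y : 𝟙 ((t - 1ℤ) * b₁ ≈? w) ≡ 𝟙 (+ y * (a₂ * b₁ - a₁ * b₂) ≈? (b₁ - b₂) * a₁)
    equation-in-y = begin
      𝟙 ((t - 1ℤ) * b₁ ≈? w)                  ≡⟨ 𝟙-⇔ ((t - 1ℤ) * b₁ ≈? w) ((t - 1ℤ) * b₁ * a₁ ≈? w * a₁)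
                                                     (λ e → *-cong e (≈-refl {a₁}))
                                                     (λ e → *-cancelˡ-≈ a₁≉0 (≈-trans (≈-reflexive (ℤP.*-comm a₁ _)) (≈-trans e (≈-reflexive (ℤP.*-comm w a₁))))) ⟩
      𝟙 ((t - 1ℤ) * b₁ * a₁ ≈? w * a₁)        ≡⟨ 𝟙≈-cong (≈-trans (≈-reflexive (swap (t - 1ℤ) b₁ a₁)) (*-cong [t-1]a₁≈ya₂-a₁ (≈-refl {b₁}))) (≈-refl {w * a₁}) ⟩
      𝟙 ((ya₂ - a₁) * b₁ ≈? w * a₁)           ≡⟨ 𝟙≈-transport (collect (+ y) a₁ b₁ a₂ b₂) ⟩
      𝟙 (+ y * (a₂ * b₁ - a₁ * b₂) ≈? (b₁ - b₂) * a₁) ∎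
      where
      swap : ∀ i j k → i * j * k ≡ i * k * j
      swap = solve-∀
      collect : ∀ y a₁ b₁ a₂ b₂ → (y * a₂ - a₁) * b₁ - (y - 1ℤ) * b₂ * a₁ ≡ y * (a₂ * b₁ - a₁ * b₂) - (b₁ - b₂) * a₁
      collect = solve-∀

  module _ {a₁ b₁ a₂ b₂ : ℤ} (a₁≉0 : a₁ ≉ 0ℤ) (b₁≉0 : b₁ ≉ 0ℤ) (a₂≉0 : a₂ ≉ 0ℤ) (b₂≉0 : b₂ ≉ 0ℤ) where

    private
      K c₀ : ℤ
      K  = a₂ * b₁ - a₁ * b₂
      c₀ = (b₁ - b₂) * a₁

      h : ℕ → ℕ
      h y = 𝟙≉0 (+ y - 1ℤ)

      ∑-in-y : ℕ
      ∑-in-y = ∑ U (λ y → h y ℕ.* (𝟙≉0 (+ y * a₂ - a₁) ℕ.* 𝟙 (+ y * K ≈? c₀)))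

      both-counts : ℕ
      both-counts = (p ∸ 2) ℕ.* (𝟙 (a₁ ≈? a₂) ℕ.* 𝟙 (b₁ ≈? b₂))
                    ℕ.+ 𝟙≉0 (a₁ - a₂) ℕ.* 𝟙≉0 (b₁ - b₂) ℕ.* 𝟙≉0 (a₁ * b₂ - a₂ * b₁)

      𝟙≉0[cross]≡𝟙≉0[K] : 𝟙≉0 (a₁ * b₂ - a₂ * b₁) ≡ 𝟙≉0 K
      𝟙≉0[cross]≡𝟙≉0[K] = trans (cong 𝟙≉0 (negate a₁ b₁ a₂ b₂)) (𝟙≉0-neg K)
        where negate : ∀ a₁ b₁ a₂ b₂ → a₁ * b₂ - a₂ * b₁ ≡ - (a₂ * b₁ - a₁ * b₂)
              negate = solve-∀

      c : ℤ
      c = c₀ * K ⁻¹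

      g : ℤ → ℕ
      g z = 𝟙≉0 (z - 1ℤ) ℕ.* 𝟙≉0 (z * a₂ - a₁)

      module _ (K≉0 : K ≉ 0ℤ) where

        cK≈c₀ : c * K ≈ c₀
        cK≈c₀ = ≈*⁻¹⇒*≈ {j = c₀} K≉0 (≈-refl {c})

        𝟙≉0[c] : 𝟙≉0 c ≡ 𝟙≉0 (b₁ - b₂)
        𝟙≉0[c] = trans (𝟙≉0-scale K≉0 cK≈c₀) (𝟙≉0-*-≉0 a₁≉0)

        𝟙≉0[c-1] : 𝟙≉0 (c - 1ℤ) ≡ 𝟙≉0 (a₁ - a₂)
        𝟙≉0[c-1] = trans (𝟙≉0-scale K≉0 (begin
          (c - 1ℤ) * K    ≡⟨ expand c K ⟩
          c * K - K       ≈⟨ minus-cong cK≈c₀ (≈-refl {K}) ⟩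
          c₀ - K          ≡⟨ collect a₁ b₁ a₂ b₂ ⟩
          (a₁ - a₂) * b₁  ∎)) (𝟙≉0-*-≉0 b₁≉0)
          where
          open ≈-Reasoning
          expand : ∀ c K → (c - 1ℤ) * K ≡ c * K - K
          expand = solve-∀
          collect : ∀ a₁ b₁ a₂ b₂ → (b₁ - b₂) * a₁ - (a₂ * b₁ - a₁ * b₂) ≡ (a₁ - a₂) * b₁
          collect = solve-∀

        𝟙≉0[ca₂-a₁] : 𝟙≉0 (c * a₂ - a₁) ≡ 𝟙≉0 (a₁ - a₂)
        𝟙≉0[ca₂-a₁] = trans (𝟙≉0-scale K≉0 (begin
          (c * a₂ - a₁) * K      ≡⟨ expand c a₂ a₁ K ⟩
          c * K * a₂ - a₁ * K    ≈⟨ minus-cong (*-cong cK≈c₀ (≈-refl {a₂})) (≈-refl {a₁ * K}) ⟩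
          c₀ * a₂ - a₁ * K       ≡⟨ collect a₁ b₁ a₂ b₂ ⟩
          (a₁ - a₂) * (a₁ * b₂)  ∎)) (𝟙≉0-*-≉0 (*-≉0 a₁≉0 b₂≉0))
          where
          open ≈-Reasoning
          expand : ∀ c a₂ a₁ K → (c * a₂ - a₁) * K ≡ c * K * a₂ - a₁ * K
          expand = solve-∀
          collect : ∀ a₁ b₁ a₂ b₂ → (b₁ - b₂) * a₁ * a₂ - a₁ * (a₂ * b₁ - a₁ * b₂) ≡ (a₁ - a₂) * (a₁ * b₂)
          collect = solve-∀

        not-both : 𝟙 (a₁ ≈? a₂) ℕ.* 𝟙 (b₁ ≈? b₂) ≡ 0
        not-both = 𝟙*𝟙-exclusive (a₁ ≈? a₂) (b₁ ≈? b₂) λ a₁≈a₂ b₁≈b₂ → K≉0 (begin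
          a₂ * b₁ - a₁ * b₂   ≈⟨ minus-cong (≈-refl {a₂ * b₁}) (*-cong a₁≈a₂ (≈-sym b₁≈b₂)) ⟩
          a₂ * b₁ - a₂ * b₁   ≡⟨ ℤP.+-inverseʳ (a₂ * b₁) ⟩
          0ℤ                  ∎)
          where open ≈-Reasoning

      ∑-in-y-nonsingular : K ≉ 0ℤ → ∑-in-y ≡ both-counts
      ∑-in-y-nonsingular K≉0 = begin
        ∑-in-y
          ≡⟨ ∑-cong U (λ y → trans (sym (ℕP.*-assoc (h y) _ _))
                                  (cong (g (+ y) ℕ.*_) (𝟙-⇔ (+ y * K ≈? c₀) (+ y ≈? c) (*≈⇒≈*⁻¹ K≉0) (≈*⁻¹⇒*≈ K≉0)))) ⟩
        ∑ U (λ y → g (+ y) ℕ.* 𝟙 (+ y ≈? c))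
          ≡⟨ ∑U-𝟙≈-weighted g (λ i≈j → cong₂ ℕ._*_ (𝟙≉0-cong (minus-cong i≈j (≈-refl {1ℤ})))
                                                   (𝟙≉0-cong (minus-cong (*-cong i≈j (≈-refl {a₂})) (≈-refl {a₁})))) c ⟩
        𝟙≉0 (c - 1ℤ) ℕ.* 𝟙≉0 (c * a₂ - a₁) ℕ.* 𝟙≉0 c
          ≡⟨ cong₂ ℕ._*_ (cong₂ ℕ._*_ (𝟙≉0[c-1] K≉0) (𝟙≉0[ca₂-a₁] K≉0)) (𝟙≉0[c] K≉0) ⟩
        𝟙≉0 (a₁ - a₂) ℕ.* 𝟙≉0 (a₁ - a₂) ℕ.* 𝟙≉0 (b₁ - b₂)
          ≡⟨ cong (ℕ._* 𝟙≉0 (b₁ - b₂)) (𝟙≉0-idem (a₁ - a₂)) ⟩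
        𝟙≉0 (a₁ - a₂) ℕ.* 𝟙≉0 (b₁ - b₂)
          ≡⟨ ℕP.*-identityʳ _ ⟨
        𝟙≉0 (a₁ - a₂) ℕ.* 𝟙≉0 (b₁ - b₂) ℕ.* 1
          ≡⟨ cong (𝟙≉0 (a₁ - a₂) ℕ.* 𝟙≉0 (b₁ - b₂) ℕ.*_) (trans 𝟙≉0[cross]≡𝟙≉0[K] (𝟙≉0-≉0 K≉0)) ⟨
        𝟙≉0 (a₁ - a₂) ℕ.* 𝟙≉0 (b₁ - b₂) ℕ.* 𝟙≉0 (a₁ * b₂ - a₂ * b₁)
          ≡⟨ cong (ℕ._+ 𝟙≉0 (a₁ - a₂) ℕ.* 𝟙≉0 (b₁ - b₂) ℕ.* 𝟙≉0 (a₁ * b₂ - a₂ * b₁)) (trans (cong ((p ∸ 2) ℕ.*_) (not-both K≉0)) (ℕP.*-zeroʳ (p ∸ 2))) ⟨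
        both-counts ∎
        where open ≡-Reasoning

      module _ (K≈0 : K ≈ 0ℤ) where

        𝟙[yK≈c₀] : ∀ y → 𝟙 (+ y * K ≈? c₀) ≡ 𝟙 (b₁ ≈? b₂)
        𝟙[yK≈c₀] y = 𝟙-⇔ (+ y * K ≈? c₀) (b₁ ≈? b₂)
          (λ yK≈c₀ → -≈0⇒≈ (*-≈0-≉0ʳ a₁≉0 (≈-trans (≈-sym yK≈c₀) yK≈0)))
          (λ b₁≈b₂ → ≈-trans yK≈0 (≈-sym (c₀≈0 b₁≈b₂)))
          where yK≈0 = ≈-trans (*-cong (≈-refl {+ y}) K≈0) (≈-reflexive (ℤP.*-zeroʳ (+ y)))
                c₀≈0 : b₁ ≈ b₂ → c₀ ≈ 0ℤ
                c₀≈0 b₁≈b₂ = ≈-trans (*-cong (≈⇒-≈0 b₁≈b₂) (≈-refl {a₁})) (≈-reflexive (ℤP.*-zeroˡ a₁))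

        𝟙≉0[cross]≡0 : 𝟙≉0 (a₁ * b₂ - a₂ * b₁) ≡ 0
        𝟙≉0[cross]≡0 = trans 𝟙≉0[cross]≡𝟙≉0[K] (𝟙≉0-≈0 K≈0)

        b₁≈b₂⇒a₁≈a₂ : b₁ ≈ b₂ → a₁ ≈ a₂
        b₁≈b₂⇒a₁≈a₂ b₁≈b₂ = ≈-sym (-≈0⇒≈ (*-≈0-≉0ʳ b₁≉0 (begin
          (a₂ - a₁) * b₁                 ≡⟨ collect a₁ b₁ a₂ b₂ ⟩
          K - (b₁ - b₂) * a₁             ≈⟨ minus-cong K≈0 (*-cong (≈⇒-≈0 b₁≈b₂) (≈-refl {a₁})) ⟩
          0ℤ - 0ℤ * a₁                   ≡⟨ cong (λ z → 0ℤ - z) (ℤP.*-zeroˡ a₁) ⟩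
          0ℤ                             ∎)))
          where
          open ≈-Reasoning
          collect : ∀ a₁ b₁ a₂ b₂ → (a₂ - a₁) * b₁ ≡ (a₂ * b₁ - a₁ * b₂) - (b₁ - b₂) * a₁
          collect = solve-∀

      ∑-in-y-singular : K ≈ 0ℤ → ∑-in-y ≡ both-counts
      ∑-in-y-singular K≈0 = by-cases (b₁ ≈? b₂)
        where
        open ≡-Reasoning
        by-cases : Dec (b₁ ≈ b₂) → ∑-in-y ≡ both-counts
        by-cases (yes b₁≈b₂) = begin
          ∑-in-y
            ≡⟨ ∑-cong U (λ y → cong (λ n → h y ℕ.* (𝟙≉0 (+ y * a₂ - a₁) ℕ.* n)) (trans (𝟙[yK≈c₀] K≈0 y) (𝟙-yes (b₁ ≈? b₂) b₁≈b₂))) ⟩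
          ∑ U (λ y → h y ℕ.* (𝟙≉0 (+ y * a₂ - a₁) ℕ.* 1))
            ≡⟨ ∑-cong U (λ y → trans (cong (h y ℕ.*_) (trans (ℕP.*-identityʳ _) (𝟙≉0[ya₂-a₁] y))) (𝟙≉0-idem (+ y - 1ℤ))) ⟩
          ∑ U h
            ≡⟨ ∑U-𝟙≉0[x-1] ⟩
          p ∸ 2
            ≡⟨ ℕP.+-identityʳ (p ∸ 2) ⟨
          p ∸ 2 ℕ.+ 0
            ≡⟨ cong₂ ℕ._+_ (sym (trans (cong ((p ∸ 2) ℕ.*_) (cong₂ ℕ._*_ (𝟙-yes (a₁ ≈? a₂) a₁≈a₂) (𝟙-yes (b₁ ≈? b₂) b₁≈b₂))) (ℕP.*-identityʳ (p ∸ 2))))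
                           (sym (cong (λ n → n ℕ.* 𝟙≉0 (b₁ - b₂) ℕ.* 𝟙≉0 (a₁ * b₂ - a₂ * b₁)) (𝟙≉0-≈0 (≈⇒-≈0 a₁≈a₂)))) ⟩
          both-counts ∎
          where
          a₁≈a₂ = b₁≈b₂⇒a₁≈a₂ K≈0 b₁≈b₂
          𝟙≉0[ya₂-a₁] : ∀ y → 𝟙≉0 (+ y * a₂ - a₁) ≡ 𝟙≉0 (+ y - 1ℤ)
          𝟙≉0[ya₂-a₁] y = trans (𝟙≉0-cong (minus-cong (*-cong (≈-refl {+ y}) (≈-sym a₁≈a₂)) (≈-refl {a₁})))
                                (trans (cong 𝟙≉0 (factor (+ y) a₁)) (𝟙≉0-*-≉0 a₁≉0))
            where factor : ∀ y a → y * a - a ≡ (y - 1ℤ) * a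
                  factor = solve-∀
        by-cases (no b₁≉b₂) = begin
          ∑-in-y
            ≡⟨ ∑-cong U (λ y → cong (λ n → h y ℕ.* (𝟙≉0 (+ y * a₂ - a₁) ℕ.* n)) (trans (𝟙[yK≈c₀] K≈0 y) (𝟙-no (b₁ ≈? b₂) b₁≉b₂))) ⟩
          ∑ U (λ y → h y ℕ.* (𝟙≉0 (+ y * a₂ - a₁) ℕ.* 0))
            ≡⟨ ∑-cong U (λ y → trans (cong (h y ℕ.*_) (ℕP.*-zeroʳ (𝟙≉0 (+ y * a₂ - a₁)))) (ℕP.*-zeroʳ (h y))) ⟩
          ∑ U (λ _ → 0)
            ≡⟨ ∑-zero U ⟩
          0 ℕ.+ 0
            ≡⟨ cong₂ ℕ._+_ (sym (trans (cong (λ n → (p ∸ 2) ℕ.* (𝟙 (a₁ ≈? a₂) ℕ.* n)) (𝟙-no (b₁ ≈? b₂) b₁≉b₂))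
                                       (trans (cong ((p ∸ 2) ℕ.*_) (ℕP.*-zeroʳ (𝟙 (a₁ ≈? a₂)))) (ℕP.*-zeroʳ (p ∸ 2)))))
                           (sym (trans (cong (𝟙≉0 (a₁ - a₂) ℕ.* 𝟙≉0 (b₁ - b₂) ℕ.*_) (𝟙≉0[cross]≡0 K≈0)) (ℕP.*-zeroʳ (𝟙≉0 (a₁ - a₂) ℕ.* 𝟙≉0 (b₁ - b₂))))) ⟩
          both-counts ∎

    ∑∑≉1-both≈ : ∑∑≉1 (λ x y → 𝟙 (+ x * a₁ ≈? + y * a₂) ℕ.* 𝟙 ((+ x - 1ℤ) * b₁ ≈? (+ y - 1ℤ) * b₂))
                 ≡ (p ∸ 2) ℕ.* (𝟙 (a₁ ≈? a₂) ℕ.* 𝟙 (b₁ ≈? b₂))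
                   ℕ.+ 𝟙≉0 (a₁ - a₂) ℕ.* 𝟙≉0 (b₁ - b₂) ℕ.* 𝟙≉0 (a₁ * b₂ - a₂ * b₁)
    ∑∑≉1-both≈ = begin
      ∑∑≉1 F                                                       ≡⟨ ∑∑≉1-inner F ⟩
      ∑ U (λ y → h y ℕ.* ∑ U (λ x → 𝟙≉0 (+ x - 1ℤ) ℕ.* F x y))     ≡⟨ ∑-congᴬ U-≉0 (λ y y≉0 → cong (h y ℕ.*_) (∑U-both-inner y a₁≉0 a₂≉0 y≉0)) ⟩
      ∑-in-y                                                       ≡⟨ by-K (K ≈? 0ℤ) ⟩
      both-counts                                                  ∎
      where
      open ≡-Reasoning
      F = λ x y → 𝟙 (+ x * a₁ ≈? + y * a₂) ℕ.* 𝟙 ((+ x - 1ℤ) * b₁ ≈? (+ y - 1ℤ) * b₂)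
      by-K : Dec (K ≈ 0ℤ) → ∑-in-y ≡ both-counts
      by-K (yes K≈0) = ∑-in-y-singular K≈0
      by-K (no K≉0)  = ∑-in-y-nonsingular K≉0

  𝟙≉0-*-cong : ∀ {m n} i → (i ≉ 0ℤ → m ≡ n) → 𝟙≉0 i ℕ.* m ≡ 𝟙≉0 i ℕ.* n
  𝟙≉0-*-cong {m} {n} i m≡n with i ≈? 0ℤ
  ... | yes _    = refl
  ... | no i≉0   = cong (1 ℕ.*_) (m≡n i≉0)

  -- Pairs of tuples

  T : ℕ → List (List ℕ)
  T = tuples p

  ∏ ∏₋₁ : List ℕ → ℤ
  ∏   = prodℤ
  ∏₋₁ = prodMinus1

  ∑T-suc : ∀ s (f : List ℕ → ℕ) → ∑ (T (suc s)) f ≡ ∑ U (λ x → ∑ (T s) (λ xs → f (x ∷ xs)))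
  ∑T-suc s f = trans (∑-concatMap (λ x → List.map (x ∷_) (T s)) U f) (∑-cong U (λ x → ∑-map (x ∷_) (T s) f))

  ∏-≉0 : ∀ s → All (λ xs → ∏ xs ≉ 0ℤ) (T s)
  ∏-≉0 zero    = 1≉0 ∷ []
  ∏-≉0 (suc s) = AllP.concat⁺ (AllP.map⁺ (All.map (λ x≉0 → AllP.map⁺ (All.map (*-≉0 x≉0) (∏-≉0 s))) U-≉0))

  ∑T-1 : ∀ s → ∑ (T s) (λ _ → 1) ≡ (p ∸ 1) ℕ.^ s
  ∑T-1 zero    = refl
  ∑T-1 (suc s) = begin
    ∑ (T (suc s)) (λ _ → 1)          ≡⟨ ∑T-suc s (λ _ → 1) ⟩
    ∑ U (λ _ → ∑ (T s) (λ _ → 1))    ≡⟨ ∑-cong U (λ _ → ∑T-1 s) ⟩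
    ∑ U (λ _ → (p ∸ 1) ℕ.^ s)        ≡⟨ ∑-const U _ ⟩
    length U ℕ.* (p ∸ 1) ℕ.^ s       ≡⟨ cong (ℕ._* (p ∸ 1) ℕ.^ s) length-U ⟩
    (p ∸ 1) ℕ.^ suc s                ∎
    where open ≡-Reasoning

  ∑T-𝟙≉0[∏₋₁] : ∀ s → ∑ (T s) (λ xs → 𝟙≉0 (∏₋₁ xs)) ≡ (p ∸ 2) ℕ.^ s
  ∑T-𝟙≉0[∏₋₁] zero    = cong (ℕ._+ 0) (𝟙≉0-≉0 1≉0)
  ∑T-𝟙≉0[∏₋₁] (suc s) = begin
    ∑ (T (suc s)) (λ xs → 𝟙≉0 (∏₋₁ xs))                                 ≡⟨ ∑T-suc s (λ xs → 𝟙≉0 (∏₋₁ xs)) ⟩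
    ∑ U (λ x → ∑ (T s) (λ xs → 𝟙≉0 ((+ x - 1ℤ) * ∏₋₁ xs)))               ≡⟨ ∑-cong U (λ x → trans (∑-cong (T s) (λ xs → 𝟙≉0-* (+ x - 1ℤ) (∏₋₁ xs))) (∑-*ˡ (T s) (𝟙≉0 (+ x - 1ℤ)) (λ xs → 𝟙≉0 (∏₋₁ xs)))) ⟩
    ∑ U (λ x → 𝟙≉0 (+ x - 1ℤ) ℕ.* ∑ (T s) (λ xs → 𝟙≉0 (∏₋₁ xs)))         ≡⟨ ∑-*ʳ U (∑ (T s) (λ xs → 𝟙≉0 (∏₋₁ xs))) (λ x → 𝟙≉0 (+ x - 1ℤ)) ⟩
    ∑ U (λ x → 𝟙≉0 (+ x - 1ℤ)) ℕ.* ∑ (T s) (λ xs → 𝟙≉0 (∏₋₁ xs))         ≡⟨ cong₂ ℕ._*_ ∑U-𝟙≉0[x-1] (∑T-𝟙≉0[∏₋₁] s) ⟩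
    (p ∸ 2) ℕ.^ suc s                                                   ∎
    where open ≡-Reasoning

  ∑T-𝟙[∏≈] : ∀ s {c} → c ≉ 0ℤ → ∑ (T (suc s)) (λ xs → 𝟙 (∏ xs ≈? c)) ≡ (p ∸ 1) ℕ.^ s
  ∑T-𝟙[∏≈] s {c} c≉0 = begin
    ∑ (T (suc s)) (λ xs → 𝟙 (∏ xs ≈? c))                       ≡⟨ ∑T-suc s (λ xs → 𝟙 (∏ xs ≈? c)) ⟩
    ∑ U (λ x → ∑ (T s) (λ xs → 𝟙 (+ x * ∏ xs ≈? c)))           ≡⟨ ∑-comm U (T s) (λ x xs → 𝟙 (+ x * ∏ xs ≈? c)) ⟩
    ∑ (T s) (λ xs → ∑ U (λ x → 𝟙 (+ x * ∏ xs ≈? c)))           ≡⟨ ∑-congᴬ (∏-≉0 s) one-solution ⟩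
    ∑ (T s) (λ _ → 1)                                          ≡⟨ ∑T-1 s ⟩
    (p ∸ 1) ℕ.^ s                                                ∎
    where
    open ≡-Reasoning
    one-solution : ∀ xs → ∏ xs ≉ 0ℤ → ∑ U (λ x → 𝟙 (+ x * ∏ xs ≈? c)) ≡ 1
    one-solution xs a≉0 = trans (∑-cong U (λ x → 𝟙-⇔ (+ x * ∏ xs ≈? c) (+ x ≈? c * ∏ xs ⁻¹) (*≈⇒≈*⁻¹ a≉0) (≈*⁻¹⇒*≈ a≉0)))
                                (trans (∑U-𝟙≈ (c * ∏ xs ⁻¹)) (𝟙≉0-≉0 (*-≉0 c≉0 (⁻¹-≉0 a≉0))))

  ∑² : ℕ → (List ℕ → List ℕ → ℕ) → ℕ
  ∑² s F = ∑ (T s) λ xs → ∑ (T s) λ ys → F xs ys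

  ∑²-cong : ∀ s {F G : List ℕ → List ℕ → ℕ} →
            (∀ xs ys → ∏ xs ≉ 0ℤ → ∏ ys ≉ 0ℤ → F xs ys ≡ G xs ys) → ∑² s F ≡ ∑² s G
  ∑²-cong s F≗G = ∑-congᴬ (∏-≉0 s) λ xs ∏xs≉0 → ∑-congᴬ (∏-≉0 s) λ ys ∏ys≉0 → F≗G xs ys ∏xs≉0 ∏ys≉0

  ∑²-+ : ∀ s (F G : List ℕ → List ℕ → ℕ) → ∑² s (λ xs ys → F xs ys ℕ.+ G xs ys) ≡ ∑² s F ℕ.+ ∑² s G
  ∑²-+ s F G = trans (∑-cong (T s) (λ xs → ∑-+ (T s) (F xs) (G xs))) (∑-+ (T s) _ _)

  ∑²-*ˡ : ∀ s c (F : List ℕ → List ℕ → ℕ) → ∑² s (λ xs ys → c ℕ.* F xs ys) ≡ c ℕ.* ∑² s F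
  ∑²-*ˡ s c F = trans (∑-cong (T s) (λ xs → ∑-*ˡ (T s) c (F xs))) (∑-*ˡ (T s) c _)

  ∑²-suc : ∀ s (F : List ℕ → List ℕ → ℕ) →
           ∑² (suc s) F ≡ ∑² s (λ xs ys → ∑ U λ x → ∑ U λ y → F (x ∷ xs) (y ∷ ys))
  ∑²-suc s F = begin
    ∑² (suc s) F
      ≡⟨ trans (∑T-suc s _) (∑-cong U (λ x → ∑-cong (T s) (λ xs → ∑T-suc s (F (x ∷ xs))))) ⟩
    ∑ U (λ x → ∑ (T s) λ xs → ∑ U λ y → ∑ (T s) λ ys → F (x ∷ xs) (y ∷ ys))
      ≡⟨ ∑-comm U (T s) _ ⟩
    ∑ (T s) (λ xs → ∑ U λ x → ∑ U λ y → ∑ (T s) λ ys → F (x ∷ xs) (y ∷ ys))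
      ≡⟨ ∑-cong (T s) (λ xs → trans (∑-cong U (λ x → ∑-comm U (T s) _)) (∑-comm U (T s) _)) ⟩
    ∑² s (λ xs ys → ∑ U λ x → ∑ U λ y → F (x ∷ xs) (y ∷ ys)) ∎
    where open ≡-Reasoning

  ∑ᵂ : ℕ → (List ℕ → List ℕ → ℕ) → ℕ
  ∑ᵂ s F = ∑² s (λ xs ys → 𝟙≉0 (∏₋₁ xs) ℕ.* (𝟙≉0 (∏₋₁ ys) ℕ.* F xs ys))

  ∑ᵂ-cong : ∀ s {F G : List ℕ → List ℕ → ℕ} →
            (∀ xs ys → ∏ xs ≉ 0ℤ → ∏ ys ≉ 0ℤ → ∏₋₁ xs ≉ 0ℤ → ∏₋₁ ys ≉ 0ℤ → F xs ys ≡ G xs ys) → ∑ᵂ s F ≡ ∑ᵂ s G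
  ∑ᵂ-cong s F≗G = ∑²-cong s λ xs ys ∏xs≉0 ∏ys≉0 →
    𝟙≉0-*-cong (∏₋₁ xs) λ ∏₋₁xs≉0 → 𝟙≉0-*-cong (∏₋₁ ys) λ ∏₋₁ys≉0 → F≗G xs ys ∏xs≉0 ∏ys≉0 ∏₋₁xs≉0 ∏₋₁ys≉0

  ∑ᵂ-+ : ∀ s (F G : List ℕ → List ℕ → ℕ) → ∑ᵂ s (λ xs ys → F xs ys ℕ.+ G xs ys) ≡ ∑ᵂ s F ℕ.+ ∑ᵂ s G
  ∑ᵂ-+ s F G = trans (∑²-cong s λ xs ys _ _ → distrib (𝟙≉0 (∏₋₁ xs)) (𝟙≉0 (∏₋₁ ys)) (F xs ys) (G xs ys)) (∑²-+ s _ _)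
    where distrib : ∀ b d f g → b ℕ.* (d ℕ.* (f ℕ.+ g)) ≡ b ℕ.* (d ℕ.* f) ℕ.+ b ℕ.* (d ℕ.* g)
          distrib = ℕ-Solver.solve-∀

  ∑ᵂ-*ˡ : ∀ s c (F : List ℕ → List ℕ → ℕ) → ∑ᵂ s (λ xs ys → c ℕ.* F xs ys) ≡ c ℕ.* ∑ᵂ s F
  ∑ᵂ-*ˡ s c F = trans (∑²-cong s λ xs ys _ _ → swap (𝟙≉0 (∏₋₁ xs)) (𝟙≉0 (∏₋₁ ys)) c (F xs ys)) (∑²-*ˡ s c _)
    where swap : ∀ b d c f → b ℕ.* (d ℕ.* (c ℕ.* f)) ≡ c ℕ.* (b ℕ.* (d ℕ.* f))
          swap = ℕ-Solver.solve-∀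

  ∑ᵂ-suc : ∀ s (F : List ℕ → List ℕ → ℕ) →
           ∑ᵂ (suc s) F ≡ ∑ᵂ s (λ xs ys → ∑∑≉1 (λ x y → F (x ∷ xs) (y ∷ ys)))
  ∑ᵂ-suc s F = trans (∑²-suc s _) (∑²-cong s λ xs ys _ _ → begin
    ∑ U (λ x → ∑ U λ y → 𝟙≉0 ((+ x - 1ℤ) * ∏₋₁ xs) ℕ.* (𝟙≉0 ((+ y - 1ℤ) * ∏₋₁ ys) ℕ.* F (x ∷ xs) (y ∷ ys)))
      ≡⟨ ∑-cong U (λ x → ∑-cong U λ y → trans (cong₂ (λ m n → m ℕ.* (n ℕ.* F (x ∷ xs) (y ∷ ys))) (𝟙≉0-* (+ x - 1ℤ) (∏₋₁ xs)) (𝟙≉0-* (+ y - 1ℤ) (∏₋₁ ys)))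
                                               (regroup (𝟙≉0 (+ x - 1ℤ)) (𝟙≉0 (∏₋₁ xs)) (𝟙≉0 (+ y - 1ℤ)) (𝟙≉0 (∏₋₁ ys)) (F (x ∷ xs) (y ∷ ys)))) ⟩
    ∑ U (λ x → ∑ U λ y → 𝟙≉0 (∏₋₁ xs) ℕ.* 𝟙≉0 (∏₋₁ ys) ℕ.* (𝟙≉0 (+ x - 1ℤ) ℕ.* 𝟙≉0 (+ y - 1ℤ) ℕ.* F (x ∷ xs) (y ∷ ys)))
      ≡⟨ trans (∑-cong U (λ x → ∑-*ˡ U (𝟙≉0 (∏₋₁ xs) ℕ.* 𝟙≉0 (∏₋₁ ys)) _)) (∑-*ˡ U (𝟙≉0 (∏₋₁ xs) ℕ.* 𝟙≉0 (∏₋₁ ys)) _) ⟩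
    𝟙≉0 (∏₋₁ xs) ℕ.* 𝟙≉0 (∏₋₁ ys) ℕ.* ∑∑≉1 (λ x y → F (x ∷ xs) (y ∷ ys))
      ≡⟨ ℕP.*-assoc (𝟙≉0 (∏₋₁ xs)) (𝟙≉0 (∏₋₁ ys)) _ ⟩
    𝟙≉0 (∏₋₁ xs) ℕ.* (𝟙≉0 (∏₋₁ ys) ℕ.* ∑∑≉1 (λ x y → F (x ∷ xs) (y ∷ ys))) ∎)
    where
    open ≡-Reasoning
    regroup : ∀ a b c d f → a ℕ.* b ℕ.* (c ℕ.* d ℕ.* f) ≡ b ℕ.* d ℕ.* (a ℕ.* c ℕ.* f)
    regroup = ℕ-Solver.solve-∀

  ∑ᵂ-[] : ∀ F → ∑ᵂ 0 F ≡ F [] []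
  ∑ᵂ-[] F = begin
    𝟙≉0 (+ 1) ℕ.* (𝟙≉0 (+ 1) ℕ.* F [] []) ℕ.+ 0 ℕ.+ 0   ≡⟨ trans (ℕP.+-identityʳ _) (ℕP.+-identityʳ _) ⟩
    𝟙≉0 (+ 1) ℕ.* (𝟙≉0 (+ 1) ℕ.* F [] [])               ≡⟨ cong₂ (λ m n → m ℕ.* (n ℕ.* F [] [])) (𝟙≉0-≉0 1≉0) (𝟙≉0-≉0 1≉0) ⟩
    1 ℕ.* (1 ℕ.* F [] [])                               ≡⟨ trans (ℕP.*-identityˡ _) (ℕP.*-identityˡ _) ⟩
    F [] []                                             ∎
    where open ≡-Reasoning

  ∑ᵂ-1 : ∀ s → ∑ᵂ s (λ _ _ → 1) ≡ (p ∸ 2) ℕ.^ s ℕ.* (p ∸ 2) ℕ.^ s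
  ∑ᵂ-1 s = begin
    ∑ᵂ s (λ _ _ → 1)                                                 ≡⟨ ∑²-cong s (λ xs ys _ _ → cong (𝟙≉0 (∏₋₁ xs) ℕ.*_) (ℕP.*-identityʳ _)) ⟩
    ∑ (T s) (λ xs → ∑ (T s) λ ys → 𝟙≉0 (∏₋₁ xs) ℕ.* 𝟙≉0 (∏₋₁ ys))         ≡⟨ trans (∑-cong (T s) λ xs → ∑-*ˡ (T s) (𝟙≉0 (∏₋₁ xs)) _) (∑-*ʳ (T s) _ _) ⟩
    ∑ (T s) (λ xs → 𝟙≉0 (∏₋₁ xs)) ℕ.* ∑ (T s) (λ ys → 𝟙≉0 (∏₋₁ ys))      ≡⟨ cong₂ ℕ._*_ (∑T-𝟙≉0[∏₋₁] s) (∑T-𝟙≉0[∏₋₁] s) ⟩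
    (p ∸ 2) ℕ.^ s ℕ.* (p ∸ 2) ℕ.^ s                                   ∎
    where open ≡-Reasoning

  *-cancelʳ-≈ : k ≉ 0ℤ → i * k ≈ j * k → i ≈ j
  *-cancelʳ-≈ {k} {i} {j} k≉0 ik≈jk =
    *-cancelˡ-≈ k≉0 (≈-trans (≈-reflexive (ℤP.*-comm k i)) (≈-trans ik≈jk (≈-reflexive (ℤP.*-comm j k))))

  ∑ᵂ-𝟙≈+𝟙≉0 : ∀ s (L R : List ℕ → List ℕ → ℤ) →
    ∑ᵂ s (λ xs ys → 𝟙 (L xs ys ≈? R xs ys)) ℕ.+ ∑ᵂ s (λ xs ys → 𝟙≉0 (L xs ys - R xs ys)) ≡ ∑ᵂ s (λ _ _ → 1)
  ∑ᵂ-𝟙≈+𝟙≉0 s L R = trans (sym (∑ᵂ-+ s _ _)) (∑ᵂ-cong s λ xs ys _ _ _ _ → 𝟙≈+𝟙≉0 (L xs ys) (R xs ys))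

  ∑ᵂ-𝟙≈-suc : ∀ (L R : List ℕ → List ℕ → ℤ) →
    (∀ xs ys → ∏ xs ≉ 0ℤ → ∏ ys ≉ 0ℤ → ∏₋₁ xs ≉ 0ℤ → ∏₋₁ ys ≉ 0ℤ →
       ∑∑≉1 (λ x y → 𝟙 (L (x ∷ xs) (y ∷ ys) ≈? R (x ∷ xs) (y ∷ ys))) ℕ.+ 𝟙≉0 (L xs ys - R xs ys) ≡ p ∸ 2) →
    ∀ s → ∑ᵂ (suc s) (λ xs ys → 𝟙 (L xs ys ≈? R xs ys)) ℕ.+ ∑ᵂ s (λ xs ys → 𝟙≉0 (L xs ys - R xs ys))
          ≡ (p ∸ 2) ℕ.* ∑ᵂ s (λ _ _ → 1)
  ∑ᵂ-𝟙≈-suc L R one-step s = begin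
    ∑ᵂ (suc s) (λ xs ys → 𝟙 (L xs ys ≈? R xs ys)) ℕ.+ ∑ᵂ s H
      ≡⟨ cong (ℕ._+ ∑ᵂ s H) (∑ᵂ-suc s _) ⟩
    ∑ᵂ s (λ xs ys → ∑∑≉1 (λ x y → 𝟙 (L (x ∷ xs) (y ∷ ys) ≈? R (x ∷ xs) (y ∷ ys)))) ℕ.+ ∑ᵂ s H
      ≡⟨ ∑ᵂ-+ s _ H ⟨
    ∑ᵂ s (λ xs ys → ∑∑≉1 (λ x y → 𝟙 (L (x ∷ xs) (y ∷ ys) ≈? R (x ∷ xs) (y ∷ ys))) ℕ.+ H xs ys)
      ≡⟨ ∑ᵂ-cong s (λ xs ys a a′ b b′ → trans (one-step xs ys a a′ b b′) (sym (ℕP.*-identityʳ (p ∸ 2)))) ⟩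
    ∑ᵂ s (λ _ _ → (p ∸ 2) ℕ.* 1)
      ≡⟨ ∑ᵂ-*ˡ s (p ∸ 2) (λ _ _ → 1) ⟩
    (p ∸ 2) ℕ.* ∑ᵂ s (λ _ _ → 1) ∎
    where
    open ≡-Reasoning
    H = λ xs ys → 𝟙≉0 (L xs ys - R xs ys)

  pairs-∏≈ pairs-∏₋₁≈ pairs-ratio≈ pairs-both≈ pairs-none≈ : ℕ → ℕ
  pairs-∏≈ s   = ∑ᵂ s (λ xs ys → 𝟙 (∏ xs ≈? ∏ ys))
  pairs-∏₋₁≈ s   = ∑ᵂ s (λ xs ys → 𝟙 (∏₋₁ xs ≈? ∏₋₁ ys))
  pairs-ratio≈ s = ∑ᵂ s (λ xs ys → 𝟙 (∏ xs * ∏₋₁ ys ≈? ∏ ys * ∏₋₁ xs))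
  pairs-both≈ s = ∑ᵂ s (λ xs ys → 𝟙 (∏ xs ≈? ∏ ys) ℕ.* 𝟙 (∏₋₁ xs ≈? ∏₋₁ ys))
  pairs-none≈ s = ∑ᵂ s (λ xs ys → 𝟙≉0 (∏ xs - ∏ ys) ℕ.* 𝟙≉0 (∏₋₁ xs - ∏₋₁ ys) ℕ.* 𝟙≉0 (∏ xs * ∏₋₁ ys - ∏ ys * ∏₋₁ xs))

  pairs-both≈-suc : ∀ s → pairs-both≈ (suc s) ≡ (p ∸ 2) ℕ.* pairs-both≈ s ℕ.+ pairs-none≈ s
  pairs-both≈-suc s = begin
    pairs-both≈ (suc s)
      ≡⟨ ∑ᵂ-suc s _ ⟩
    ∑ᵂ s (λ xs ys → ∑∑≉1 (λ x y → 𝟙 (+ x * ∏ xs ≈? + y * ∏ ys) ℕ.* 𝟙 ((+ x - 1ℤ) * ∏₋₁ xs ≈? (+ y - 1ℤ) * ∏₋₁ ys)))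
      ≡⟨ ∑ᵂ-cong s (λ xs ys a₁≉0 a₂≉0 b₁≉0 b₂≉0 → ∑∑≉1-both≈ a₁≉0 b₁≉0 a₂≉0 b₂≉0) ⟩
    ∑ᵂ s (λ xs ys → (p ∸ 2) ℕ.* (𝟙 (∏ xs ≈? ∏ ys) ℕ.* 𝟙 (∏₋₁ xs ≈? ∏₋₁ ys))
                    ℕ.+ 𝟙≉0 (∏ xs - ∏ ys) ℕ.* 𝟙≉0 (∏₋₁ xs - ∏₋₁ ys) ℕ.* 𝟙≉0 (∏ xs * ∏₋₁ ys - ∏ ys * ∏₋₁ xs))
      ≡⟨ ∑ᵂ-+ s _ _ ⟩
    ∑ᵂ s (λ xs ys → (p ∸ 2) ℕ.* (𝟙 (∏ xs ≈? ∏ ys) ℕ.* 𝟙 (∏₋₁ xs ≈? ∏₋₁ ys))) ℕ.+ pairs-none≈ s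
      ≡⟨ cong (ℕ._+ pairs-none≈ s) (∑ᵂ-*ˡ s (p ∸ 2) _) ⟩
    (p ∸ 2) ℕ.* pairs-both≈ s ℕ.+ pairs-none≈ s ∎
    where open ≡-Reasoning

  pairs-inclusion-exclusion : ∀ s →
    pairs-none≈ s ℕ.+ pairs-∏≈ s ℕ.+ pairs-∏₋₁≈ s ℕ.+ pairs-ratio≈ s ≡ ∑ᵂ s (λ _ _ → 1) ℕ.+ 2 ℕ.* pairs-both≈ s
  pairs-inclusion-exclusion s = begin
    pairs-none≈ s ℕ.+ pairs-∏≈ s ℕ.+ pairs-∏₋₁≈ s ℕ.+ pairs-ratio≈ s
      ≡⟨ cong (ℕ._+ pairs-ratio≈ s) (trans (cong (ℕ._+ pairs-∏₋₁≈ s) (sym (∑ᵂ-+ s _ _))) (sym (∑ᵂ-+ s _ _))) ⟩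
    ∑ᵂ s (λ xs ys → E xs ys ℕ.+ 𝟙 (∏ xs ≈? ∏ ys) ℕ.+ 𝟙 (∏₋₁ xs ≈? ∏₋₁ ys)) ℕ.+ pairs-ratio≈ s
      ≡⟨ ∑ᵂ-+ s _ _ ⟨
    ∑ᵂ s (λ xs ys → E xs ys ℕ.+ 𝟙 (∏ xs ≈? ∏ ys) ℕ.+ 𝟙 (∏₋₁ xs ≈? ∏₋₁ ys) ℕ.+ 𝟙 (∏ xs * ∏₋₁ ys ≈? ∏ ys * ∏₋₁ xs))
      ≡⟨ ∑ᵂ-cong s (λ xs ys a₁≉0 a₂≉0 b₁≉0 b₂≉0 → two-of-three a₁≉0 b₁≉0 a₂≉0 b₂≉0) ⟩
    ∑ᵂ s (λ xs ys → 1 ℕ.+ 2 ℕ.* (𝟙 (∏ xs ≈? ∏ ys) ℕ.* 𝟙 (∏₋₁ xs ≈? ∏₋₁ ys)))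
      ≡⟨ trans (∑ᵂ-+ s _ _) (cong (∑ᵂ s (λ _ _ → 1) ℕ.+_) (∑ᵂ-*ˡ s 2 _)) ⟩
    ∑ᵂ s (λ _ _ → 1) ℕ.+ 2 ℕ.* pairs-both≈ s ∎
    where
    open ≡-Reasoning
    E = λ xs ys → 𝟙≉0 (∏ xs - ∏ ys) ℕ.* 𝟙≉0 (∏₋₁ xs - ∏₋₁ ys) ℕ.* 𝟙≉0 (∏ xs * ∏₋₁ ys - ∏ ys * ∏₋₁ xs)
    two-of-three : ∀ {a₁ b₁ a₂ b₂} → a₁ ≉ 0ℤ → b₁ ≉ 0ℤ → a₂ ≉ 0ℤ → b₂ ≉ 0ℤ →
      𝟙≉0 (a₁ - a₂) ℕ.* 𝟙≉0 (b₁ - b₂) ℕ.* 𝟙≉0 (a₁ * b₂ - a₂ * b₁) ℕ.+ 𝟙 (a₁ ≈? a₂) ℕ.+ 𝟙 (b₁ ≈? b₂) ℕ.+ 𝟙 (a₁ * b₂ ≈? a₂ * b₁)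
        ≡ 1 ℕ.+ 2 ℕ.* (𝟙 (a₁ ≈? a₂) ℕ.* 𝟙 (b₁ ≈? b₂))
    two-of-three {a₁} {b₁} {a₂} {b₂} a₁≉0 b₁≉0 a₂≉0 b₂≉0 =
      trans (cong (λ n → n ℕ.+ 𝟙 (a₁ ≈? a₂) ℕ.+ 𝟙 (b₁ ≈? b₂) ℕ.+ 𝟙 (a₁ * b₂ ≈? a₂ * b₁))
                  (cong₂ ℕ._*_ (cong₂ ℕ._*_ (𝟙≉0[-]≡𝟙≉ a₁ a₂) (𝟙≉0[-]≡𝟙≉ b₁ b₂)) (𝟙≉0[-]≡𝟙≉ (a₁ * b₂) (a₂ * b₁))))
            (𝟙-two-of-three (a₁ ≈? a₂) (b₁ ≈? b₂) (a₁ * b₂ ≈? a₂ * b₁)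
              (λ a₁≈a₂ b₁≈b₂ → *-cong a₁≈a₂ (≈-sym b₁≈b₂))
              (λ a₁≈a₂ a₁b₂≈a₂b₁ → ≈-sym (*-cancelˡ-≈ a₂≉0 (≈-trans (*-cong (≈-sym a₁≈a₂) (≈-refl {b₂})) a₁b₂≈a₂b₁)))
              (λ b₁≈b₂ a₁b₂≈a₂b₁ → *-cancelʳ-≈ b₂≉0 (≈-trans a₁b₂≈a₂b₁ (*-cong (≈-refl {a₂}) b₁≈b₂))))

  pairs-single≈ : ℕ → ℕ
  pairs-single≈ s = pairs-∏≈ s ℕ.+ pairs-∏₋₁≈ s ℕ.+ pairs-ratio≈ s

  pairs-both≈-suc+single≈ : ∀ s → pairs-both≈ (suc s) ℕ.+ pairs-single≈ s ≡ (p ∸ 2) ℕ.* pairs-both≈ s ℕ.+ (∑ᵂ s (λ _ _ → 1) ℕ.+ 2 ℕ.* pairs-both≈ s)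
  pairs-both≈-suc+single≈ s = begin
    pairs-both≈ (suc s) ℕ.+ pairs-single≈ s
      ≡⟨ cong (ℕ._+ pairs-single≈ s) (pairs-both≈-suc s) ⟩
    (p ∸ 2) ℕ.* pairs-both≈ s ℕ.+ pairs-none≈ s ℕ.+ (pairs-∏≈ s ℕ.+ pairs-∏₋₁≈ s ℕ.+ pairs-ratio≈ s)
      ≡⟨ regroup ((p ∸ 2) ℕ.* pairs-both≈ s) (pairs-none≈ s) (pairs-∏≈ s) (pairs-∏₋₁≈ s) (pairs-ratio≈ s) ⟩
    (p ∸ 2) ℕ.* pairs-both≈ s ℕ.+ (pairs-none≈ s ℕ.+ pairs-∏≈ s ℕ.+ pairs-∏₋₁≈ s ℕ.+ pairs-ratio≈ s)
      ≡⟨ cong ((p ∸ 2) ℕ.* pairs-both≈ s ℕ.+_) (pairs-inclusion-exclusion s) ⟩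
    (p ∸ 2) ℕ.* pairs-both≈ s ℕ.+ (∑ᵂ s (λ _ _ → 1) ℕ.+ 2 ℕ.* pairs-both≈ s) ∎
    where
    open ≡-Reasoning
    regroup : ∀ a e x y z → a ℕ.+ e ℕ.+ (x ℕ.+ y ℕ.+ z) ≡ a ℕ.+ (e ℕ.+ x ℕ.+ y ℕ.+ z)
    regroup = ℕ-Solver.solve-∀

  𝒯≡∑² : ∀ s → 𝒯 p s ≡ ∑² s (λ xs ys → 𝟙 (∏ xs ≈? ∏ ys) ℕ.* 𝟙 (∏₋₁ xs ≈? ∏₋₁ ys))
  𝒯≡∑² s = begin
    𝒯 p s
      ≡⟨ length-filter≡∑𝟙 (cond? p) (cartesianProduct (T s) (T s)) ⟩
    ∑ (cartesianProduct (T s) (T s)) (λ xy → 𝟙 (cond? p xy))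
      ≡⟨ ∑-cartesianProduct (T s) (T s) _ ⟩
    ∑² s (λ xs ys → 𝟙 (cond? p (xs , ys)))
      ≡⟨ ∑²-cong s (λ xs ys _ _ → trans (𝟙-× (≡[mod]? xs ys) (≡[mod]?₋₁ xs ys))
                                         (cong₂ ℕ._*_ (𝟙-⇔ (≡[mod]? xs ys) (∏ xs ≈? ∏ ys) mk≈ ≈⇒≡[mod])
                                                      (𝟙-⇔ (≡[mod]?₋₁ xs ys) (∏₋₁ xs ≈? ∏₋₁ ys) mk≈ ≈⇒≡[mod]))) ⟩
    ∑² s (λ xs ys → 𝟙 (∏ xs ≈? ∏ ys) ℕ.* 𝟙 (∏₋₁ xs ≈? ∏₋₁ ys)) ∎
    where
    open ≡-Reasoning
    ≡[mod]? : ∀ xs ys → Dec (prodℤ xs ≡ prodℤ ys [mod p ])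
    ≡[mod]?₋₁ : ∀ xs ys → Dec (prodMinus1 xs ≡ prodMinus1 ys [mod p ])
    ≡[mod]? xs ys   = prodℤ xs ≡? prodℤ ys [mod p ]
    ≡[mod]?₋₁ xs ys = prodMinus1 xs ≡? prodMinus1 ys [mod p ]

  -- b ≈ b′ holds exactly when b and b′ are both units and equal, or both ≈ 0.
  𝟙≈-split : ∀ c b b′ → c ℕ.* 𝟙 (b ≈? b′) ℕ.+ (𝟙≉0 b ℕ.+ 𝟙≉0 b′) ℕ.* c
                        ≡ 𝟙≉0 b ℕ.* (𝟙≉0 b′ ℕ.* (c ℕ.* 𝟙 (b ≈? b′))) ℕ.+ c ℕ.+ 𝟙≉0 b ℕ.* (𝟙≉0 b′ ℕ.* c)
  𝟙≈-split c b b′ = by-cases (b ≈? 0ℤ) (b′ ≈? 0ℤ)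
    where
    e = 𝟙 (b ≈? b′)
    c*0+c : c ℕ.* 0 ℕ.+ (c ℕ.+ 0) ≡ c ℕ.+ 0
    c*0+c = cong (ℕ._+ (c ℕ.+ 0)) (ℕP.*-zeroʳ c)
    by-cases : (d : Dec (b ≈ 0ℤ)) (d′ : Dec (b′ ≈ 0ℤ)) →
      c ℕ.* e ℕ.+ (𝟙 (¬? d) ℕ.+ 𝟙 (¬? d′)) ℕ.* c ≡ 𝟙 (¬? d) ℕ.* (𝟙 (¬? d′) ℕ.* (c ℕ.* e)) ℕ.+ c ℕ.+ 𝟙 (¬? d) ℕ.* (𝟙 (¬? d′) ℕ.* c)
    by-cases (yes b≈0) (yes b′≈0) = cong (ℕ._+ 0) (trans (cong (c ℕ.*_) (𝟙-yes (b ≈? b′) (≈-trans b≈0 (≈-sym b′≈0)))) (ℕP.*-identityʳ c))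
    by-cases (yes b≈0) (no b′≉0)  = trans (cong (λ n → c ℕ.* n ℕ.+ (c ℕ.+ 0)) (𝟙-no (b ≈? b′) (λ b≈b′ → b′≉0 (≈-trans (≈-sym b≈b′) b≈0)))) c*0+c
    by-cases (no b≉0)  (yes b′≈0) = trans (cong (λ n → c ℕ.* n ℕ.+ (c ℕ.+ 0)) (𝟙-no (b ≈? b′) (λ b≈b′ → b≉0 (≈-trans b≈b′ b′≈0)))) c*0+c
    by-cases (no _)    (no _)     = begin
      c ℕ.* e ℕ.+ (c ℕ.+ (c ℕ.+ 0))                          ≡⟨ cong (λ n → c ℕ.* e ℕ.+ (c ℕ.+ n)) (ℕP.+-identityʳ c) ⟩
      c ℕ.* e ℕ.+ (c ℕ.+ c)                                  ≡⟨ ℕP.+-assoc (c ℕ.* e) c c ⟨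
      c ℕ.* e ℕ.+ c ℕ.+ c                                    ≡⟨ cong₂ (λ m n → m ℕ.+ c ℕ.+ n) (sym (trans (ℕP.*-identityˡ (1 ℕ.* (c ℕ.* e))) (ℕP.*-identityˡ (c ℕ.* e))))
                                                                                             (sym (trans (ℕP.*-identityˡ (1 ℕ.* c)) (ℕP.*-identityˡ c))) ⟩
      1 ℕ.* (1 ℕ.* (c ℕ.* e)) ℕ.+ c ℕ.+ 1 ℕ.* (1 ℕ.* c)      ∎
      where open ≡-Reasoning

  ∑T-𝟙[≈∏] : ∀ s {c} → c ≉ 0ℤ → ∑ (T (suc s)) (λ ys → 𝟙 (c ≈? ∏ ys)) ≡ (p ∸ 1) ℕ.^ s
  ∑T-𝟙[≈∏] s {c} c≉0 = trans (∑-cong (T (suc s)) (λ ys → 𝟙-⇔ (c ≈? ∏ ys) (∏ ys ≈? c) ≈-sym ≈-sym)) (∑T-𝟙[∏≈] s c≉0)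

  ∑²-𝟙[∏≈] : ∀ s (w : List ℕ → ℕ) →
    ∑² (suc s) (λ xs ys → w xs ℕ.* 𝟙 (∏ xs ≈? ∏ ys)) ≡ ∑ (T (suc s)) w ℕ.* (p ∸ 1) ℕ.^ s
  ∑²-𝟙[∏≈] s w = begin
    ∑² (suc s) (λ xs ys → w xs ℕ.* 𝟙 (∏ xs ≈? ∏ ys))
      ≡⟨ ∑-cong (T (suc s)) (λ xs → ∑-*ˡ (T (suc s)) (w xs) _) ⟩
    ∑ (T (suc s)) (λ xs → w xs ℕ.* ∑ (T (suc s)) (λ ys → 𝟙 (∏ xs ≈? ∏ ys)))
      ≡⟨ ∑-congᴬ (∏-≉0 (suc s)) (λ xs ∏xs≉0 → cong (w xs ℕ.*_) (∑T-𝟙[≈∏] s ∏xs≉0)) ⟩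
    ∑ (T (suc s)) (λ xs → w xs ℕ.* (p ∸ 1) ℕ.^ s)
      ≡⟨ ∑-*ʳ (T (suc s)) _ w ⟩
    ∑ (T (suc s)) w ℕ.* (p ∸ 1) ℕ.^ s ∎
    where open ≡-Reasoning

  ∑²-𝟙[≈∏] : ∀ s (w : List ℕ → ℕ) →
    ∑² (suc s) (λ xs ys → w ys ℕ.* 𝟙 (∏ xs ≈? ∏ ys)) ≡ ∑ (T (suc s)) w ℕ.* (p ∸ 1) ℕ.^ s
  ∑²-𝟙[≈∏] s w = trans (∑-comm (T (suc s)) (T (suc s)) _)
    (trans (∑-cong (T (suc s)) λ ys → ∑-cong (T (suc s)) λ xs → cong (w ys ℕ.*_) (𝟙-⇔ (∏ xs ≈? ∏ ys) (∏ ys ≈? ∏ xs) ≈-sym ≈-sym))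
           (∑²-𝟙[∏≈] s w))

  𝒯-decomposition : ∀ s →
    𝒯 p (suc s) ℕ.+ ((p ∸ 2) ℕ.^ suc s ℕ.* (p ∸ 1) ℕ.^ s ℕ.+ (p ∸ 2) ℕ.^ suc s ℕ.* (p ∸ 1) ℕ.^ s)
      ≡ pairs-both≈ (suc s) ℕ.+ ((p ∸ 1) ℕ.^ suc s ℕ.* (p ∸ 1) ℕ.^ s ℕ.+ pairs-∏≈ (suc s))
  𝒯-decomposition s = begin
    𝒯 p s′ ℕ.+ ((p ∸ 2) ℕ.^ s′ ℕ.* (p ∸ 1) ℕ.^ s ℕ.+ (p ∸ 2) ℕ.^ s′ ℕ.* (p ∸ 1) ℕ.^ s)
      ≡⟨ cong₂ ℕ._+_ (𝒯≡∑² s′) (sym (cong₂ ℕ._+_ (trans (∑²-𝟙[∏≈] s (λ xs → 𝟙≉0 (∏₋₁ xs))) (cong (ℕ._* (p ∸ 1) ℕ.^ s) (∑T-𝟙≉0[∏₋₁] s′)))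
                                                    (trans (∑²-𝟙[≈∏] s (λ ys → 𝟙≉0 (∏₋₁ ys))) (cong (ℕ._* (p ∸ 1) ℕ.^ s) (∑T-𝟙≉0[∏₋₁] s′))))) ⟩
    ∑² s′ (λ xs ys → c xs ys ℕ.* 𝟙 (∏₋₁ xs ≈? ∏₋₁ ys)) ℕ.+ (∑² s′ (λ xs ys → 𝟙≉0 (∏₋₁ xs) ℕ.* c xs ys) ℕ.+ ∑² s′ (λ xs ys → 𝟙≉0 (∏₋₁ ys) ℕ.* c xs ys))
      ≡⟨ trans (cong (∑² s′ (λ xs ys → c xs ys ℕ.* 𝟙 (∏₋₁ xs ≈? ∏₋₁ ys)) ℕ.+_) (sym (∑²-+ s′ _ _))) (sym (∑²-+ s′ _ _)) ⟩
    ∑² s′ (λ xs ys → c xs ys ℕ.* 𝟙 (∏₋₁ xs ≈? ∏₋₁ ys) ℕ.+ (𝟙≉0 (∏₋₁ xs) ℕ.* c xs ys ℕ.+ 𝟙≉0 (∏₋₁ ys) ℕ.* c xs ys))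
      ≡⟨ ∑²-cong s′ (λ xs ys _ _ → trans (cong (c xs ys ℕ.* 𝟙 (∏₋₁ xs ≈? ∏₋₁ ys) ℕ.+_) (sym (ℕP.*-distribʳ-+ (c xs ys) (𝟙≉0 (∏₋₁ xs)) _)))
                                        (𝟙≈-split (c xs ys) (∏₋₁ xs) (∏₋₁ ys))) ⟩
    ∑² s′ (λ xs ys → 𝟙≉0 (∏₋₁ xs) ℕ.* (𝟙≉0 (∏₋₁ ys) ℕ.* (c xs ys ℕ.* 𝟙 (∏₋₁ xs ≈? ∏₋₁ ys))) ℕ.+ c xs ys ℕ.+ 𝟙≉0 (∏₋₁ xs) ℕ.* (𝟙≉0 (∏₋₁ ys) ℕ.* c xs ys))
      ≡⟨ trans (∑²-+ s′ _ _) (trans (cong (ℕ._+ pairs-∏≈ s′) (∑²-+ s′ _ _)) (ℕP.+-assoc (pairs-both≈ s′) _ _)) ⟩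
    pairs-both≈ s′ ℕ.+ (∑² s′ c ℕ.+ pairs-∏≈ s′)
      ≡⟨ cong (λ m → pairs-both≈ s′ ℕ.+ (m ℕ.+ pairs-∏≈ s′))
              (trans (∑²-cong s′ (λ _ _ _ _ → sym (ℕP.*-identityˡ _))) (trans (∑²-𝟙[∏≈] s (λ _ → 1)) (cong (ℕ._* (p ∸ 1) ℕ.^ s) (∑T-1 s′)))) ⟩
    pairs-both≈ s′ ℕ.+ ((p ∸ 1) ℕ.^ s′ ℕ.* (p ∸ 1) ℕ.^ s ℕ.+ pairs-∏≈ s′) ∎
    where
    open ≡-Reasoning
    s′ : ℕ
    s′ = suc s
    c = λ xs ys → 𝟙 (∏ xs ≈? ∏ ys)

  -- Closed forms

  private
    2≤p : 2 ℕ.≤ p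
    2≤p = nonTrivial⇒n>1 p {{prime⇒nonTrivial p-prime}}

    1≤p : 1 ℕ.≤ p
    1≤p = ℕP.<⇒≤ 2≤p

  +[p∸k] : ∀ k → k ℕ.≤ p → + (p ∸ k) ≡ + p - + k
  +[p∸k] k k≤p = sym (trans (ℤP.[+m]-[+n]≡m⊖n p k) (ℤP.⊖-≥ k≤p))

  +[p∸k]^ : ∀ k s → k ℕ.≤ p → + ((p ∸ k) ℕ.^ s) ≡ (+ p - + k) ^ s
  +[p∸k]^ k s k≤p = trans (pos-^ (p ∸ k) s) (cong (_^ s) (+[p∸k] k k≤p))

  +[p∸k]^*[p∸1]^ : ∀ k n s → k ℕ.≤ p → + ((p ∸ k) ℕ.^ n ℕ.* (p ∸ 1) ℕ.^ s) ≡ (+ p - + k) ^ n * (+ p - + 1) ^ s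
  +[p∸k]^*[p∸1]^ k n s k≤p = trans (ℤP.pos-* ((p ∸ k) ℕ.^ n) _) (cong₂ _*_ (+[p∸k]^ k n k≤p) (+[p∸k]^ 1 s 1≤p))

  +∑ᵂ-1 : ∀ s → + ∑ᵂ s (λ _ _ → 1) ≡ (+ p - + 2) ^ s * (+ p - + 2) ^ s
  +∑ᵂ-1 s = trans (cong +_ (∑ᵂ-1 s)) (trans (ℤP.pos-* ((p ∸ 2) ℕ.^ s) ((p ∸ 2) ℕ.^ s)) (cong₂ _*_ (+[p∸k]^ 2 s 2≤p) (+[p∸k]^ 2 s 2≤p)))

  pairs-≈-closed : ∀ (L R : List ℕ → List ℕ → ℤ) → L [] [] ≈ R [] [] →
    (∀ xs ys → ∏ xs ≉ 0ℤ → ∏ ys ≉ 0ℤ → ∏₋₁ xs ≉ 0ℤ → ∏₋₁ ys ≉ 0ℤ →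
       ∑∑≉1 (λ x y → 𝟙 (L (x ∷ xs) (y ∷ ys) ≈? R (x ∷ xs) (y ∷ ys))) ℕ.+ 𝟙≉0 (L xs ys - R xs ys) ≡ p ∸ 2) →
    ∀ s → (+ p - + 1) * + ∑ᵂ s (λ xs ys → 𝟙 (L xs ys ≈? R xs ys)) ≡ (+ p - + 2) ^ s * (+ p - + 2) ^ s + (+ p - + 2)
  pairs-≈-closed L R base one-step = square-recurrence (+ p) (λ s → + S s) (cong +_ (trans (∑ᵂ-[] (λ xs ys → 𝟙 (L xs ys ≈? R xs ys))) (𝟙-yes (L [] [] ≈? R [] []) base))) step
    where
    S : ℕ → ℕ
    S s = ∑ᵂ s (λ xs ys → 𝟙 (L xs ys ≈? R xs ys))
    step : ∀ s → + S (suc s) ≡ (+ p - + 3) * ((+ p - + 2) ^ s * (+ p - + 2) ^ s) + + S s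
    step s = begin
      + S (suc s)                                                   ≡⟨ complement-step {k = p ∸ 2} (∑ᵂ-𝟙≈-suc L R one-step s) (∑ᵂ-𝟙≈+𝟙≉0 s L R) ⟩
      (+ (p ∸ 2) - + 1) * + ∑ᵂ s (λ _ _ → 1) + + S s               ≡⟨ cong₂ (λ u v → (u - + 1) * v + + S s) (+[p∸k] 2 2≤p) (+∑ᵂ-1 s) ⟩
      (+ p - + 2 - + 1) * ((+ p - + 2) ^ s * (+ p - + 2) ^ s) + + S s    ≡⟨ cong (λ u → u * ((+ p - + 2) ^ s * (+ p - + 2) ^ s) + + S s) (simplify (+ p)) ⟩
      (+ p - + 3) * ((+ p - + 2) ^ s * (+ p - + 2) ^ s) + + S s          ∎
      where
      open ≡-Reasoning
      simplify : ∀ P → P - + 2 - + 1 ≡ P - + 3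
      simplify = solve-∀

  pairs-∏≈-closed : ∀ s → (+ p - + 1) * + pairs-∏≈ s ≡ (+ p - + 2) ^ s * (+ p - + 2) ^ s + (+ p - + 2)
  pairs-∏≈-closed = pairs-≈-closed (λ xs _ → ∏ xs) (λ _ ys → ∏ ys) ≈-refl
    (λ _ _ ∏xs≉0 ∏ys≉0 _ _ → ∑∑≉1-∏≈ ∏xs≉0 ∏ys≉0)

  pairs-∏₋₁≈-closed : ∀ s → (+ p - + 1) * + pairs-∏₋₁≈ s ≡ (+ p - + 2) ^ s * (+ p - + 2) ^ s + (+ p - + 2)
  pairs-∏₋₁≈-closed = pairs-≈-closed (λ xs _ → ∏₋₁ xs) (λ _ ys → ∏₋₁ ys) ≈-refl
    (λ _ _ _ _ ∏₋₁xs≉0 ∏₋₁ys≉0 → ∑∑≉1-∏₋₁≈ ∏₋₁xs≉0 ∏₋₁ys≉0)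

  pairs-ratio≈-closed : ∀ s → (+ p - + 1) * + pairs-ratio≈ s ≡ (+ p - + 2) ^ s * (+ p - + 2) ^ s + (+ p - + 2)
  pairs-ratio≈-closed = pairs-≈-closed (λ xs ys → ∏ xs * ∏₋₁ ys) (λ xs ys → ∏ ys * ∏₋₁ xs) ≈-refl
    (λ _ _ ∏xs≉0 ∏ys≉0 ∏₋₁xs≉0 ∏₋₁ys≉0 → ∑∑≉1-ratio≈ ∏xs≉0 ∏₋₁xs≉0 ∏ys≉0 ∏₋₁ys≉0)

  pairs-single≈-closed : ∀ s → (+ p - + 1) * + pairs-single≈ s ≡ + 3 * ((+ p - + 2) ^ s * (+ p - + 2) ^ s + (+ p - + 2))
  pairs-single≈-closed s = begin
    (+ p - + 1) * + pairs-single≈ s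
      ≡⟨ cong ((+ p - + 1) *_) (trans (ℤP.pos-+ (pairs-∏≈ s ℕ.+ pairs-∏₋₁≈ s) _) (cong (_+ + pairs-ratio≈ s) (ℤP.pos-+ (pairs-∏≈ s) _))) ⟩
    (+ p - + 1) * (+ pairs-∏≈ s + + pairs-∏₋₁≈ s + + pairs-ratio≈ s)
      ≡⟨ distribute (+ p - + 1) (+ pairs-∏≈ s) (+ pairs-∏₋₁≈ s) (+ pairs-ratio≈ s) ⟩
    (+ p - + 1) * + pairs-∏≈ s + (+ p - + 1) * + pairs-∏₋₁≈ s + (+ p - + 1) * + pairs-ratio≈ s
      ≡⟨ cong₂ _+_ (cong₂ _+_ (pairs-∏≈-closed s) (pairs-∏₋₁≈-closed s)) (pairs-ratio≈-closed s) ⟩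
    N + N + N
      ≡⟨ triple N ⟩
    + 3 * N ∎
    where
    open ≡-Reasoning
    N = (+ p - + 2) ^ s * (+ p - + 2) ^ s + (+ p - + 2)
    distribute : ∀ c a b d → c * (a + b + d) ≡ c * a + c * b + c * d
    distribute = solve-∀
    triple : ∀ N → N + N + N ≡ + 3 * N
    triple = solve-∀

  pairs-both≈-closed : ∀ s → (+ p - + 1) * (+ p - + 1) * + pairs-both≈ s
                              ≡ (+ p - + 2) * (+ p - + 3) * (+ p) ^ s + (+ p - + 2) ^ s * (+ p - + 2) ^ s + + 3 * (+ p - + 2)
  pairs-both≈-closed = both-recurrence (+ p) (λ s → + pairs-both≈ s) (λ s → + pairs-single≈ s) W₀ step pairs-single≈-closed
    where
    W₀ : + pairs-both≈ 0 ≡ + 1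
    W₀ = cong +_ (trans (∑ᵂ-[] (λ xs ys → 𝟙 (∏ xs ≈? ∏ ys) ℕ.* 𝟙 (∏₋₁ xs ≈? ∏₋₁ ys)))
                        (cong₂ ℕ._*_ (𝟙-yes (∏ [] ≈? ∏ []) ≈-refl) (𝟙-yes (∏₋₁ [] ≈? ∏₋₁ []) ≈-refl)))

    step : ∀ s → + pairs-both≈ (suc s) + + pairs-single≈ s ≡ (+ p) * + pairs-both≈ s + (+ p - + 2) ^ s * (+ p - + 2) ^ s
    step s = begin
      + pairs-both≈ (suc s) + + pairs-single≈ s
        ≡⟨ ℤP.pos-+ (pairs-both≈ (suc s)) (pairs-single≈ s) ⟨
      + (pairs-both≈ (suc s) ℕ.+ pairs-single≈ s)
        ≡⟨ cong +_ (pairs-both≈-suc+single≈ s) ⟩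
      + ((p ∸ 2) ℕ.* W ℕ.+ (M ℕ.+ 2 ℕ.* W))
        ≡⟨ trans (ℤP.pos-+ ((p ∸ 2) ℕ.* W) _) (cong₂ _+_ (ℤP.pos-* (p ∸ 2) W) (trans (ℤP.pos-+ M (2 ℕ.* W)) (cong (λ z → + M + z) (ℤP.pos-* 2 W)))) ⟩
      + (p ∸ 2) * + W + (+ M + + 2 * + W)
        ≡⟨ cong₂ (λ u v → u * + W + (v + + 2 * + W)) (+[p∸k] 2 2≤p) (+∑ᵂ-1 s) ⟩
      (+ p - + 2) * + W + ((+ p - + 2) ^ s * (+ p - + 2) ^ s + + 2 * + W)
        ≡⟨ collect (+ p) (+ W) ((+ p - + 2) ^ s * (+ p - + 2) ^ s) ⟩
      (+ p) * + W + (+ p - + 2) ^ s * (+ p - + 2) ^ s ∎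
      where
      open ≡-Reasoning
      W = pairs-both≈ s
      M = ∑ᵂ s (λ _ _ → 1)
      collect : ∀ P W N → (P - + 2) * W + (N + + 2 * W) ≡ P * W + N
      collect = solve-∀

  𝒯-decompositionℤ : ∀ s →
    + 𝒯 p (suc s) + ((+ p - + 2) ^ suc s * (+ p - + 1) ^ s + (+ p - + 2) ^ suc s * (+ p - + 1) ^ s)
      ≡ + pairs-both≈ (suc s) + ((+ p - + 1) ^ suc s * (+ p - + 1) ^ s + + pairs-∏≈ (suc s))
  𝒯-decompositionℤ s = begin
    + 𝒯 p (suc s) + ((+ p - + 2) ^ suc s * (+ p - + 1) ^ s + (+ p - + 2) ^ suc s * (+ p - + 1) ^ s)
      ≡⟨ cong (λ z → + 𝒯 p (suc s) + (z + z)) (sym (+[p∸k]^*[p∸1]^ 2 (suc s) s 2≤p)) ⟩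
    + 𝒯 p (suc s) + (+ N′X + + N′X)
      ≡⟨ trans (cong (λ z → + 𝒯 p (suc s) + z) (sym (ℤP.pos-+ N′X N′X))) (sym (ℤP.pos-+ (𝒯 p (suc s)) _)) ⟩
    + (𝒯 p (suc s) ℕ.+ (N′X ℕ.+ N′X))
      ≡⟨ cong +_ (𝒯-decomposition s) ⟩
    + (pairs-both≈ (suc s) ℕ.+ (X′X ℕ.+ pairs-∏≈ (suc s)))
      ≡⟨ trans (ℤP.pos-+ (pairs-both≈ (suc s)) _) (cong (λ z → + pairs-both≈ (suc s) + z) (ℤP.pos-+ X′X _)) ⟩
    + pairs-both≈ (suc s) + (+ X′X + + pairs-∏≈ (suc s))
      ≡⟨ cong (λ z → + pairs-both≈ (suc s) + (z + + pairs-∏≈ (suc s))) (+[p∸k]^*[p∸1]^ 1 (suc s) s 1≤p) ⟩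
    + pairs-both≈ (suc s) + ((+ p - + 1) ^ suc s * (+ p - + 1) ^ s + + pairs-∏≈ (suc s)) ∎
    where
    open ≡-Reasoning
    N′X = (p ∸ 2) ℕ.^ suc s ℕ.* (p ∸ 1) ℕ.^ s
    X′X = (p ∸ 1) ℕ.^ suc s ℕ.* (p ∸ 1) ℕ.^ s

  𝒯-closed-form : ∀ s →
    + ((p ∸ 1) ℕ.* (p ∸ 1)) * + 𝒯 p (suc s)
      ≡ + ((p ∸ 1) ℕ.* (p ∸ 1)) * mainTerm p (suc s)
        + (+ p) * (+ p - + 2) ^ 2 * ((+ p - + 2) ^ (2 ℕ.* suc s ∸ 2) - (+ p) ^ (suc s ∸ 1))
        - ((+ p) ^ 2 - + 4) * ((+ p) ^ (suc s ∸ 1) - + 1)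
  𝒯-closed-form s = begin
    + ((p ∸ 1) ℕ.* (p ∸ 1)) * + 𝒯 p (suc s)
      ≡⟨ cong (_* + 𝒯 p (suc s)) [p-1]²≡ ⟩
    (+ p - + 1) * (+ p - + 1) * + 𝒯 p (suc s)
      ≡⟨ closed-form-algebra (+ p) X Y Z (+ 𝒯 p (suc s)) (+ pairs-both≈ (suc s)) (+ pairs-∏≈ (suc s))
           (𝒯-decompositionℤ s) (pairs-∏≈-closed (suc s)) (pairs-both≈-closed (suc s)) ⟩
    (+ p - + 1) * (+ p - + 1) * ((+ p - + 1) * (X * X) - + 2 * (+ p - + 2) * (X * Y - Z))
      + (+ p) * (+ p - + 2) ^ 2 * (Y * Y - Z) - ((+ p) ^ 2 - + 4) * (Z - + 1)
      ≡⟨ cong₂ (λ d u → d * (u - + 2 * (+ p - + 2) * (X * Y - Z)) + (+ p) * (+ p - + 2) ^ 2 * (Y * Y - Z) - ((+ p) ^ 2 - + 4) * (Z - + 1))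
               (sym [p-1]²≡) (sym (^-2[1+s]∸1 (+ p - + 1) s)) ⟩
    + ((p ∸ 1) ℕ.* (p ∸ 1)) * mainTerm p (suc s) + (+ p) * (+ p - + 2) ^ 2 * (Y * Y - Z) - ((+ p) ^ 2 - + 4) * (Z - + 1)
      ≡⟨ cong (λ v → + ((p ∸ 1) ℕ.* (p ∸ 1)) * mainTerm p (suc s) + (+ p) * (+ p - + 2) ^ 2 * (v - Z) - ((+ p) ^ 2 - + 4) * (Z - + 1))
              (sym (^-2[1+s]∸2 (+ p - + 2) s)) ⟩
    + ((p ∸ 1) ℕ.* (p ∸ 1)) * mainTerm p (suc s) + (+ p) * (+ p - + 2) ^ 2 * ((+ p - + 2) ^ (2 ℕ.* suc s ∸ 2) - Z) - ((+ p) ^ 2 - + 4) * (Z - + 1) ∎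
    where
    open ≡-Reasoning
    X = (+ p - + 1) ^ s
    Y = (+ p - + 2) ^ s
    Z = (+ p) ^ s
    [p-1]²≡ : + ((p ∸ 1) ℕ.* (p ∸ 1)) ≡ (+ p - + 1) * (+ p - + 1)
    [p-1]²≡ = trans (ℤP.pos-* (p ∸ 1) (p ∸ 1)) (cong₂ _*_ (+[p∸k] 1 1≤p) (+[p∸k] 1 1≤p))

lemma4p4 : (p : ℕ) → Prime p → p ≢ 2 → (s : ℕ) → 1 ℕ.≤ s →
    (+ 𝒯 p s) / 1 ≡ (mainTerm p s / 1) ℚ.+ f p s
lemma4p4 0                   p-prime _   _       _ = ⊥-elim (¬prime[0] p-prime)
lemma4p4 1                   p-prime _   _       _ = ⊥-elim (¬prime[1] p-prime)
lemma4p4 2                   _       p≢2 _       _ = ⊥-elim (p≢2 refl)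
lemma4p4 p@(suc (suc (suc q))) p-prime _ (suc s) _ =
  clear-denominator (+ 𝒯 p (suc s)) (mainTerm p (suc s))
    (+ p * (+ p - + 2) ^ 2 * ((+ p - + 2) ^ (2 ℕ.* suc s ∸ 2) - (+ p) ^ (suc s ∸ 1)))
    (((+ p) ^ 2 - + 4) * ((+ p) ^ (suc s ∸ 1) - + 1))
    (suc q ℕ.+ suc q ℕ.* suc (suc q))
    (𝒯-closed-form p p-prime s)
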